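{- Let $p\ge 5$ be a prime and $G$ a non-split Cartan subgroup of $\mathrm{GL}_2(\mathbf{F}_p)$. Then the set $\{hgh^{ -1}: g\in G,\ h\in\mathrm{GL}_2(\mathbf{F}_p)\}$ has cardinality strictly greater than $p^3$ and generates $\mathrm{GL}_2(\mathbf{F}_p)$ as a group.
   Context: Identify $\mathbf{F}_p$ with the scalar matrices in $\mathrm{Mat}_2(\mathbf{F}_p)$. A non-split Cartan subgroup of $\mathrm{GL}_2(\mathbf{F}_p)$ is the multiplicative group of an $\mathbf{F}_p$-subalgebra of $\mathrm{Mat}_2(\mathbf{F}_p)$ that is a field with $p^2$ elements. -}

module Defs where

open import Data.Nat using (ℕ; NonZero; _+_; _*_; _∸_; _<_; _^_)
open import Data.Nat.DivMod using (_mod_)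
open import Data.Fin using (Fin; toℕ)
open import Data.Product using (Σ; ∃; _×_; _,_)
open import Data.List using (List; length)
open import Data.List.Relation.Unary.All using (All)
open import Data.List.Relation.Unary.Unique.Propositional using (Unique)
open import Data.List.Membership.Propositional using (_∈_)
open import Relation.Binary.PropositionalEquality using (_≡_; _≢_)

module _ (p : ℕ) .{{_ : NonZero p}} where

  F : Set
  F = Fin p

  infixl 6 _+F_ _-F_
  infixl 7 _*F_

  _+F_ : F → F → F
  a +F b = (toℕ a + toℕ b) mod p

  _*F_ : F → F → F
  a *F b = (toℕ a * toℕ b) mod p

  _-F_ : F → F → F
  a -F b = (toℕ a + (p ∸ toℕ b)) mod p

  0F 1F : F
  0F = 0 mod p
  1F = 1 mod p

  -- 2×2 matrices [[a , b] , [c , d]] over F_p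
  record Mat : Set where
    constructor mat
    field
      a b c d : F

  open Mat public

  infixl 6 _+M_
  infixl 7 _*M_

  _+M_ : Mat → Mat → Mat
  m +M n = mat (a m +F a n) (b m +F b n) (c m +F c n) (d m +F d n)

  _*M_ : Mat → Mat → Mat
  m *M n = mat (a m *F a n +F b m *F c n) (a m *F b n +F b m *F d n)
               (c m *F a n +F d m *F c n) (c m *F b n +F d m *F d n)

  scalar : F → Mat
  scalar x = mat x 0F 0F x

  0M 1M : Mat
  0M = scalar 0F
  1M = scalar 1F

  det : Mat → F
  det m = a m *F d m -F b m *F c m

  IsGL : Mat → Set
  IsGL m = det m ≢ 0F

  HasCard : (Mat → Set) → ℕ → Set
  HasCard S n = Σ (List Mat) λ L → Unique L × All S L × (∀ m → S m → m ∈ L) × length L ≡ n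

  CardGreater : (Mat → Set) → ℕ → Set
  CardGreater S n = Σ (List Mat) λ L → Unique L × All S L × n < length L

  record IsSubalgebra (A : Mat → Set) : Set where
    field
      scalar∈ : ∀ x → A (scalar x)
      +-closed : ∀ {m n} → A m → A n → A (m +M n)
      *-closed : ∀ {m n} → A m → A n → A (m *M n)

  record IsFieldOfOrder (A : Mat → Set) (q : ℕ) : Set where
    field
      *-comm : ∀ {m n} → A m → A n → m *M n ≡ n *M m
      inverse : ∀ {m} → A m → m ≢ 0M → Σ Mat λ n → A n × m *M n ≡ 1M
      card : HasCard A q

  -- G is a non-split Cartan subgroup: G = A^× for an F_p-subalgebra A of
  -- Mat_2(F_p) that is a field with p^2 elements
  IsNonSplitCartan : (Mat → Set) → Set₁
  IsNonSplitCartan G = Σ (Mat → Set) λ A →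
    IsSubalgebra A × IsFieldOfOrder A (p * p) × (∀ g → (G g → A g × g ≢ 0M) × (A g × g ≢ 0M → G g))

  ConjSet : (Mat → Set) → Mat → Set
  ConjSet G m = ∃ λ g → ∃ λ h → ∃ λ h' → G g × h *M h' ≡ 1M × h' *M h ≡ 1M × m ≡ h *M g *M h'

  -- the subgroup of GL_2(F_p) generated by S (S ⊆ GL_2 assumed by use):
  -- all finite products of elements of S and their inverses
  data Generated (S : Mat → Set) : Mat → Set where
    gen-1 : Generated S 1M
    gen-s : ∀ {x y} → S x → Generated S y → Generated S (x *M y)
    gen-inv : ∀ {x x' y} → S x → x *M x' ≡ 1M → x' *M x ≡ 1M → Generated S y → Generated S (x' *M y)

module Submission where

-- Since the scalars lie in A, F_p is itself a field.  A contains a non-scalar β; as β − l is invertible for every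
-- scalar l, the characteristic polynomial X² − tβ X + nβ of β has no root, so
-- c β ≠ 0 and its discriminant δ is nonzero.
--
-- Every matrix with nonzero lower-left entry is conjugate to the companion
-- matrix of its characteristic polynomial, so two such matrices with equal
-- trace and determinant are conjugate.  Hence:
--   * |{hgh⁻¹}| > p³: for σ ∈ {1, 2} and u ∈ F_p the elements u + σβ of G
--     have 2p distinct pairs (trace, det) (distinguished by the discriminant
--     σ²δ), and each pair is realised by p(p − 1) matrices with c ≠ 0.
--   * generation: with γ = u + β of trace T ≠ 0, the conjugates of γ and −γ
--     give every elementary matrix as a quotient X Y⁻¹, hence all of SL₂;
--     and the norm u² + uv tβ + v² nβ of A is onto F_p (a pigeonhole count of
--     squares), so every m ∈ GL₂ is g · (g⁻¹ m) with g ∈ G and g⁻¹ m ∈ SL₂.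

open import Defs
open import Data.Nat as ℕ using (ℕ; NonZero; suc; _≤_; _^_; _%_; ⌊_/2⌋)
import Data.Nat.Properties as ℕ
open import Data.Nat.DivMod using (_mod_; m%n<n; %-distribˡ-+; %-distribˡ-*; m<n⇒m%n≡m; n%n≡0)
open import Data.Nat.Primality using (Prime)
open import Data.Nat.Solver using (module +-*-Solver)
open import Data.Integer as ℤ using (ℤ; -[1+_]) renaming (+_ to ⁺_)
import Data.Integer.Properties as ℤ
open import Data.Integer.Tactic.RingSolver using (solve-∀)
open import Data.Fin as Fin using (Fin; toℕ; splitAt; join)
open import Data.Fin.Properties using (pigeonhole; join-splitAt; toℕ-injective; toℕ-fromℕ<; toℕ<n; <-irrefl)
open import Data.Sum using (inj₁; inj₂; [_,_]′)
open import Data.Product using (∃; ∃₂; _×_; _,_; proj₁; proj₂)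
open import Data.Maybe using (Maybe; just; nothing)
open import Data.Empty using (⊥-elim)
open import Data.List using (List; []; _∷_; length; lookup; map; cartesianProduct; allFin)
import Data.List.Properties as List
open import Data.List.Relation.Unary.All as All using (All)
open import Data.List.Relation.Unary.All.Properties as All using (¬All⇒Any¬)
import Data.List.Relation.Unary.Any as Any
open import Data.List.Relation.Unary.AllPairs using (_∷_)
open import Data.List.Relation.Unary.Unique.Propositional using (Unique)
import Data.List.Relation.Unary.Unique.Propositional.Properties as Unique
open import Data.List.Membership.Propositional using (_∈_)
open import Data.List.Membership.Propositional.Properties using (∈-lookup)
open import Function using (_∘_)
open import Function.Definitions using (Injective)
open import Relation.Nullary using (¬_; yes; no; Dec)
open import Relation.Nullary.Decidable using (_×-dec_)
open import Relation.Binary.PropositionalEquality hiding ([_])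
open import Algebra.Bundles using (CommutativeRing; Monoid)
open import Algebra.Structures using (IsCommutativeRing)
import Algebra.Solver.Ring.AlmostCommutativeRing as ACR
import Algebra.Solver.Monoid

images-meet : ∀ {k n} (f g : Fin k → Fin n) → Injective _≡_ _≡_ f → Injective _≡_ _≡_ g →
              n ℕ.< k ℕ.+ k → ∃₂ λ i j → f i ≡ g j
images-meet {k} f g f-inj g-inj n<2k with pigeonhole n<2k ([ f , g ]′ ∘ splitAt k)
... | i , j , i<j , e = meet (splitAt k i) (splitAt k j) splitAt-distinct e
  where
  splitAt-distinct : splitAt k i ≢ splitAt k j
  splitAt-distinct s≡t = <-irrefl (trans (sym (join-splitAt k k i)) (trans (cong (join k k) s≡t) (join-splitAt k k j))) i<j
  meet : ∀ s t → s ≢ t → [ f , g ]′ s ≡ [ f , g ]′ t → ∃₂ λ i j → f i ≡ g j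
  meet (inj₁ x) (inj₁ y) s≢t e = ⊥-elim (s≢t (cong inj₁ (f-inj e)))
  meet (inj₂ x) (inj₂ y) s≢t e = ⊥-elim (s≢t (cong inj₂ (g-inj e)))
  meet (inj₁ x) (inj₂ y) _ e = x , y , e
  meet (inj₂ x) (inj₁ y) _ e = y , x , sym e

⌊n/2⌋-bounds : ∀ n → ⌊ n /2⌋ ℕ.+ ⌊ n /2⌋ ℕ.≤ n × n ℕ.< suc ⌊ n /2⌋ ℕ.+ suc ⌊ n /2⌋
⌊n/2⌋-bounds n = subst (⌊ n /2⌋ ℕ.+ ⌊ n /2⌋ ℕ.≤_) (ℕ.⌊n/2⌋+⌈n/2⌉≡n n) (ℕ.+-monoʳ-≤ ⌊ n /2⌋ (ℕ.⌊n/2⌋≤⌈n/2⌉ n))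
               , subst (ℕ._< suc ⌊ n /2⌋ ℕ.+ suc ⌊ n /2⌋) (ℕ.⌊n/2⌋+⌈n/2⌉≡n n)
                   (ℕ.+-mono-<-≤ (ℕ.n<1+n ⌊ n /2⌋) (ℕ.⌊n/2⌋-mono (ℕ.n≤1+n (suc n))))

⌊n/2⌋<n : ∀ {n} → 0 ℕ.< n → ⌊ n /2⌋ ℕ.< n
⌊n/2⌋<n {suc n} _ = ℕ.⌊n/2⌋<n n

both-maximal : ∀ {h x y} → x ℕ.≤ h → y ℕ.≤ h → h ℕ.+ h ℕ.≤ x ℕ.+ y → x ≡ h
both-maximal x≤h y≤h 2h≤x+y =
  ℕ.≤-antisym x≤h (ℕ.≮⇒≥ (λ x<h → ℕ.<-irrefl refl (ℕ.<-≤-trans (ℕ.+-mono-<-≤ x<h y≤h) 2h≤x+y)))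

unique-lookup : ∀ {X : Set} {xs : List X} → Unique xs → ∀ {i j} → i Fin.< j → lookup xs i ≢ lookup xs j
unique-lookup (x∉xs ∷ _) {Fin.zero} {Fin.suc j} _ = All.lookup x∉xs (∈-lookup j)
unique-lookup (_ ∷ unique) {Fin.suc i} {Fin.suc j} (ℕ.s≤s i<j) = unique-lookup unique i<j

unique-length-≤ : ∀ {X : Set} {n} (f : X → Fin n) (xs : List X) → Unique xs →
                  (∀ {x y} → x ∈ xs → y ∈ xs → f x ≡ f y → x ≡ y) → length xs ℕ.≤ n
unique-length-≤ f xs unique f-inj = ℕ.≮⇒≥ λ n<len →
  let i , j , i<j , fi≡fj = pigeonhole n<len (f ∘ lookup xs)
  in unique-lookup unique i<j (f-inj (∈-lookup i) (∈-lookup j) fi≡fj)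

length-cartesianProduct : ∀ {X Y : Set} (xs : List X) (ys : List Y) →
                          length (cartesianProduct xs ys) ≡ length xs ℕ.* length ys
length-cartesianProduct [] ys = refl
length-cartesianProduct (x ∷ xs) ys =
  trans (List.length-++ (map (x ,_) ys)) (cong₂ ℕ._+_ (List.length-map (x ,_) ys) (length-cartesianProduct xs ys))

length-allFin : ∀ n → length (allFin n) ≡ n
length-allFin n = List.length-tabulate (λ i → i)

card-from-injection : ∀ {X : Set} p .{{_ : NonZero p}} {S : Mat p → Set} {n} (xs : List X) → Unique xs →
                      (f : X → Mat p) → Injective _≡_ _≡_ f → (∀ x → S (f x)) → n ℕ.< length xs → CardGreater p S n
card-from-injection p xs unique f f-inj f∈S n<len =
  map f xs , Unique.map⁺ f-inj unique , All.map⁺ (All.universal f∈S xs) , subst (_ ℕ.<_) (sym (List.length-map f xs)) n<len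

cube<2q²[q-1] : ∀ q → 3 ℕ.≤ q → q ^ 3 ℕ.< 2 ℕ.* (q ℕ.* (q ℕ.* (q ℕ.∸ 1)))
cube<2q²[q-1] (suc q) (ℕ.s≤s 2≤q) =
  subst₂ ℕ._<_ (cube (suc q)) (rearrange q) (ℕ.*-monoʳ-< (suc q ℕ.* suc q) 1+q<2q)
  where
  open +-*-Solver
  cube : ∀ n → n ℕ.* n ℕ.* n ≡ n ^ 3
  cube = solve 1 (λ n → (n :* n :* n) := (n :^ 3)) refl
  rearrange : ∀ q → suc q ℕ.* suc q ℕ.* (2 ℕ.* q) ≡ 2 ℕ.* (suc q ℕ.* (suc q ℕ.* q))
  rearrange = solve 1 (λ q → ((con 1 :+ q) :* (con 1 :+ q) :* (con 2 :* q)) := (con 2 :* ((con 1 :+ q) :* ((con 1 :+ q) :* q)))) refl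
  1+q<2q : suc q ℕ.< 2 ℕ.* q
  1+q<2q = subst (suc q ℕ.<_) (solve 1 (λ q → (q :+ q) := (con 2 :* q)) refl q)
             (subst (ℕ._≤ q ℕ.+ q) (ℕ.+-comm q 2) (ℕ.+-monoʳ-≤ q 2≤q))

-- F_p = Fin p with arithmetic mod p is a commutative ring; equalities in it
-- are proved by the ring solver with integer coefficients, interpreted in F_p
-- through the canonical map ℤ → F_p.
module ResidueRing (p : ℕ) .{{_ : NonZero p}} where

  open ≡-Reasoning

  Fp : Set
  Fp = F p

  infixl 6 _+_ _−_
  infixl 7 _*_
  infix 8 -_

  _+_ _*_ : Fp → Fp → Fp
  _+_ = _+F_ p
  _*_ = _*F_ p

  𝟘 𝟙 : Fp
  𝟘 = 0F p
  𝟙 = 1F p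

  [_] : ℕ → Fp
  [ n ] = n mod p

  -_ : Fp → Fp
  - x = [ p ℕ.∸ toℕ x ]

  _−_ : Fp → Fp → Fp
  x − y = x + - y

  toℕ-[] : ∀ n → toℕ [ n ] ≡ n % p
  toℕ-[] n = toℕ-fromℕ< (m%n<n n p)

  []-cong : ∀ {m n} → m % p ≡ n % p → [ m ] ≡ [ n ]
  []-cong {m} {n} e = toℕ-injective (trans (toℕ-[] m) (trans e (sym (toℕ-[] n))))

  [toℕ] : ∀ x → [ toℕ x ] ≡ x
  [toℕ] x = toℕ-injective (trans (toℕ-[] (toℕ x)) (m<n⇒m%n≡m (toℕ<n x)))

  []-+ : ∀ m n → [ m ℕ.+ n ] ≡ [ m ] + [ n ]
  []-+ m n = []-cong (trans (%-distribˡ-+ m n p) (cong (_% p) (sym (cong₂ ℕ._+_ (toℕ-[] m) (toℕ-[] n)))))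

  []-* : ∀ m n → [ m ℕ.* n ] ≡ [ m ] * [ n ]
  []-* m n = []-cong (trans (%-distribˡ-* m n p) (cong (_% p) (sym (cong₂ ℕ._*_ (toℕ-[] m) (toℕ-[] n)))))

  []-injective : ∀ {m n} → m ℕ.< p → n ℕ.< p → [ m ] ≡ [ n ] → m ≡ n
  []-injective {m} {n} m<p n<p e =
    trans (sym (m<n⇒m%n≡m m<p)) (trans (sym (toℕ-[] m)) (trans (cong toℕ e) (trans (toℕ-[] n) (m<n⇒m%n≡m n<p))))

  []≢𝟘 : ∀ {n} → 0 ℕ.< n → n ℕ.< p → [ n ] ≢ 𝟘
  []≢𝟘 0<n n<p e with []-injective n<p (ℕ.<-trans 0<n n<p) e
  []≢𝟘 () n<p e | refl

  𝟚 𝟛 : Fp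
  𝟚 = 𝟙 + 𝟙
  𝟛 = 𝟚 + 𝟙

  one≢zero : 1 ℕ.< p → 𝟙 ≢ 𝟘
  one≢zero = []≢𝟘 (ℕ.s≤s ℕ.z≤n)

  two≢zero : 2 ℕ.< p → 𝟚 ≢ 𝟘
  two≢zero 2<p e = []≢𝟘 (ℕ.s≤s ℕ.z≤n) 2<p (trans ([]-+ 1 1) e)

  three≢zero : 3 ℕ.< p → 𝟛 ≢ 𝟘
  three≢zero 3<p e = []≢𝟘 (ℕ.s≤s ℕ.z≤n) 3<p (trans ([]-+ 2 1) (trans (cong (_+ 𝟙) ([]-+ 1 1)) e))

  -- every element is the reduction of a natural number, so the ring laws
  -- follow from those of ℕ
  lift₁ : ∀ {f g : Fp → Fp} → (∀ m → f [ m ] ≡ g [ m ]) → ∀ x → f x ≡ g x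
  lift₁ {f} {g} h x = subst (λ y → f y ≡ g y) ([toℕ] x) (h (toℕ x))

  lift₂ : ∀ {f g : Fp → Fp → Fp} → (∀ m n → f [ m ] [ n ] ≡ g [ m ] [ n ]) → ∀ x y → f x y ≡ g x y
  lift₂ {f} {g} h x = lift₁ {f x} {g x} (λ n → lift₁ {λ y → f y [ n ]} {λ y → g y [ n ]} (λ m → h m n) x)

  lift₃ : ∀ {f g : Fp → Fp → Fp → Fp} → (∀ m n o → f [ m ] [ n ] [ o ] ≡ g [ m ] [ n ] [ o ]) →
          ∀ x y z → f x y z ≡ g x y z
  lift₃ {f} {g} h x = lift₂ {f x} {g x} (λ n o → lift₁ {λ y → f y [ n ] [ o ]} {λ y → g y [ n ] [ o ]} (λ m → h m n o) x)

  +-comm : ∀ x y → x + y ≡ y + x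
  +-comm = lift₂ λ m n → trans (sym ([]-+ m n)) (trans (cong [_] (ℕ.+-comm m n)) ([]-+ n m))

  *-comm : ∀ x y → x * y ≡ y * x
  *-comm = lift₂ λ m n → trans (sym ([]-* m n)) (trans (cong [_] (ℕ.*-comm m n)) ([]-* n m))

  +-assoc : ∀ x y z → x + y + z ≡ x + (y + z)
  +-assoc = lift₃ λ m n o → begin
    [ m ] + [ n ] + [ o ]     ≡⟨ cong (_+ [ o ]) ([]-+ m n) ⟨
    [ m ℕ.+ n ] + [ o ]       ≡⟨ []-+ (m ℕ.+ n) o ⟨
    [ m ℕ.+ n ℕ.+ o ]         ≡⟨ cong [_] (ℕ.+-assoc m n o) ⟩
    [ m ℕ.+ (n ℕ.+ o) ]       ≡⟨ []-+ m (n ℕ.+ o) ⟩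
    [ m ] + [ n ℕ.+ o ]       ≡⟨ cong ([ m ] +_) ([]-+ n o) ⟩
    [ m ] + ([ n ] + [ o ])   ∎

  *-assoc : ∀ x y z → x * y * z ≡ x * (y * z)
  *-assoc = lift₃ λ m n o → begin
    [ m ] * [ n ] * [ o ]     ≡⟨ cong (_* [ o ]) ([]-* m n) ⟨
    [ m ℕ.* n ] * [ o ]       ≡⟨ []-* (m ℕ.* n) o ⟨
    [ m ℕ.* n ℕ.* o ]         ≡⟨ cong [_] (ℕ.*-assoc m n o) ⟩
    [ m ℕ.* (n ℕ.* o) ]       ≡⟨ []-* m (n ℕ.* o) ⟩
    [ m ] * [ n ℕ.* o ]       ≡⟨ cong ([ m ] *_) ([]-* n o) ⟩
    [ m ] * ([ n ] * [ o ])   ∎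

  *-distribʳ-+ : ∀ x y z → (y + z) * x ≡ y * x + z * x
  *-distribʳ-+ = lift₃ λ m n o → begin
    ([ n ] + [ o ]) * [ m ]       ≡⟨ cong (_* [ m ]) ([]-+ n o) ⟨
    [ n ℕ.+ o ] * [ m ]           ≡⟨ []-* (n ℕ.+ o) m ⟨
    [ (n ℕ.+ o) ℕ.* m ]           ≡⟨ cong [_] (ℕ.*-distribʳ-+ m n o) ⟩
    [ n ℕ.* m ℕ.+ o ℕ.* m ]       ≡⟨ []-+ (n ℕ.* m) (o ℕ.* m) ⟩
    [ n ℕ.* m ] + [ o ℕ.* m ]     ≡⟨ cong₂ _+_ ([]-* n m) ([]-* o m) ⟩
    [ n ] * [ m ] + [ o ] * [ m ] ∎

  +-identityˡ : ∀ x → 𝟘 + x ≡ x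
  +-identityˡ = lift₁ λ m → sym ([]-+ 0 m)

  *-identityˡ : ∀ x → 𝟙 * x ≡ x
  *-identityˡ = lift₁ λ m → trans (sym ([]-* 1 m)) (cong [_] (ℕ.*-identityˡ m))

  -‿inverseʳ : ∀ x → x − x ≡ 𝟘
  -‿inverseʳ x = begin
    x + - x                       ≡⟨ cong (_+ - x) ([toℕ] x) ⟨
    [ toℕ x ] + [ p ℕ.∸ toℕ x ]   ≡⟨ []-+ (toℕ x) (p ℕ.∸ toℕ x) ⟨
    [ toℕ x ℕ.+ (p ℕ.∸ toℕ x) ]   ≡⟨ cong [_] (ℕ.m+[n∸m]≡n (ℕ.<⇒≤ (toℕ<n x))) ⟩
    [ p ]                         ≡⟨ []-cong (trans (n%n≡0 p) (sym (m<n⇒m%n≡m (ℕ.n≢0⇒n>0 (ℕ.≢-nonZero⁻¹ p))))) ⟩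
    𝟘                             ∎

  -- the remaining laws follow by commutativity
  Fp-isCommutativeRing : IsCommutativeRing _≡_ _+_ _*_ -_ 𝟘 𝟙
  Fp-isCommutativeRing = record
    { isRing = record
      { +-isAbelianGroup = record
        { isGroup = record
          { isMonoid = record
            { isSemigroup = record
              { isMagma = record { isEquivalence = isEquivalence ; ∙-cong = cong₂ _+_ }
              ; assoc = +-assoc }
            ; identity = +-identityˡ , λ x → trans (+-comm x 𝟘) (+-identityˡ x) }
          ; inverse = (λ x → trans (+-comm (- x) x) (-‿inverseʳ x)) , -‿inverseʳ
          ; ⁻¹-cong = cong -_ }
        ; comm = +-comm }
      ; *-cong = cong₂ _*_
      ; *-assoc = *-assoc
      ; *-identity = *-identityˡ , λ x → trans (*-comm x 𝟙) (*-identityˡ x)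
      ; distrib = (λ x y z → trans (*-comm x (y + z)) (trans (*-distribʳ-+ x y z) (cong₂ _+_ (*-comm y x) (*-comm z x))))
                , *-distribʳ-+ }
    ; *-comm = *-comm }

  Fp-commutativeRing : CommutativeRing _ _
  Fp-commutativeRing = record { isCommutativeRing = Fp-isCommutativeRing }

  open CommutativeRing Fp-commutativeRing public
    using (+-identityʳ; *-identityʳ; -‿inverseˡ) renaming (distribˡ to *-distribˡ-+)

  -F≡− : ∀ x y → _-F_ p x y ≡ x − y
  -F≡− x y = trans ([]-+ (toℕ x) (p ℕ.∸ toℕ y)) (cong (_+ - y) ([toℕ] x))

  open import Algebra.Properties.Ring (CommutativeRing.ring Fp-commutativeRing) using (-‿distribˡ-*)
  open import Algebra.Properties.AbelianGroup (CommutativeRing.+-abelianGroup Fp-commutativeRing) using (⁻¹-∙-comm)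
  open import Algebra.Properties.Group (CommutativeRing.+-group Fp-commutativeRing) using (⁻¹-involutive; ε⁻¹≈ε)

  cancelʳ : ∀ {x y} z → x + z ≡ y + z → x ≡ y
  cancelʳ {x} {y} z e = begin
    x               ≡⟨ +-identityʳ x ⟨
    x + 𝟘           ≡⟨ cong (x +_) (-‿inverseʳ z) ⟨
    x + (z − z)     ≡⟨ +-assoc x z (- z) ⟨
    (x + z) − z     ≡⟨ cong (_− z) e ⟩
    (y + z) − z     ≡⟨ +-assoc y z (- z) ⟩
    y + (z − z)     ≡⟨ cong (y +_) (-‿inverseʳ z) ⟩
    y + 𝟘           ≡⟨ +-identityʳ y ⟩
    y               ∎

  −≡𝟘⇒≡ : ∀ {x y} → x − y ≡ 𝟘 → x ≡ y
  −≡𝟘⇒≡ {x} {y} e = cancelʳ (- y) (trans e (sym (-‿inverseʳ y)))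

  -≢𝟘 : ∀ {x} → x ≢ 𝟘 → - x ≢ 𝟘
  -≢𝟘 {x} x≢𝟘 e = x≢𝟘 (trans (sym (⁻¹-involutive x)) (trans (cong -_ e) ε⁻¹≈ε))

  pos neg : ℤ → ℕ
  pos (⁺ n) = n
  pos -[1+ n ] = 0
  neg (⁺ n) = 0
  neg -[1+ n ] = suc n

  pos−neg : ∀ z → z ≡ ⁺ pos z ℤ.- ⁺ neg z
  pos−neg (⁺ n) = cong ⁺_ (sym (ℕ.+-identityʳ n))
  pos−neg -[1+ n ] = refl

  ι : ℤ → Fp
  ι z = [ pos z ] − [ neg z ]

  private
    interchange : ∀ x y z w → (x + y) + (z + w) ≡ (x + z) + (y + w)
    interchange x y z w = begin
      (x + y) + (z + w) ≡⟨ +-assoc x y (z + w) ⟩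
      x + (y + (z + w)) ≡⟨ cong (x +_) (+-assoc y z w) ⟨
      x + ((y + z) + w) ≡⟨ cong (λ t → x + (t + w)) (+-comm y z) ⟩
      x + ((z + y) + w) ≡⟨ cong (x +_) (+-assoc z y w) ⟩
      x + (z + (y + w)) ≡⟨ +-assoc x z (y + w) ⟨
      (x + z) + (y + w) ∎

    −-+ : ∀ x y z w → (x − y) + (z − w) ≡ (x + z) − (y + w)
    −-+ x y z w = trans (interchange x (- y) z (- w)) (cong ((x + z) +_) (⁻¹-∙-comm y w))

    −-neg : ∀ x y → - (x − y) ≡ y − x
    −-neg x y = trans (sym (⁻¹-∙-comm x (- y))) (trans (cong (- x +_) (⁻¹-involutive y)) (+-comm (- x) y))

    −-* : ∀ x y z w → (x − y) * (z − w) ≡ (x * z + y * w) − (x * w + y * z)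
    −-* x y z w = begin
      (x − y) * (z − w)                           ≡⟨ *-distribʳ-+ (z − w) x (- y) ⟩
      x * (z − w) + - y * (z − w)                 ≡⟨ cong₂ _+_ (*-distribˡ-+ x z (- w)) (*-distribˡ-+ (- y) z (- w)) ⟩
      (x * z + x * - w) + (- y * z + - y * - w)   ≡⟨ cong₂ (λ s t → (x * z + s) + t) (neg-right x w) (cong₂ _+_ (sym (-‿distribˡ-* y z)) minus-minus) ⟩
      (x * z − x * w) + (- (y * z) + y * w)       ≡⟨ cong ((x * z − x * w) +_) (+-comm (- (y * z)) (y * w)) ⟩
      (x * z − x * w) + (y * w − y * z)           ≡⟨ −-+ (x * z) (x * w) (y * w) (y * z) ⟩
      (x * z + y * w) − (x * w + y * z)           ∎
      where
      neg-right : ∀ s t → s * - t ≡ - (s * t)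
      neg-right s t = trans (*-comm s (- t)) (trans (sym (-‿distribˡ-* t s)) (cong -_ (*-comm t s)))
      minus-minus : - y * - w ≡ y * w
      minus-minus = trans (sym (-‿distribˡ-* y (- w))) (trans (cong -_ (neg-right y w)) (⁻¹-involutive (y * w)))

    ι-welldefined : ∀ a b c d → ⁺ a ℤ.- ⁺ b ≡ ⁺ c ℤ.- ⁺ d → [ a ] − [ b ] ≡ [ c ] − [ d ]
    ι-welldefined a b c d e = cancelʳ ([ b ] + [ d ]) (begin
      ([ a ] − [ b ]) + ([ b ] + [ d ]) ≡⟨ shuffle [ a ] [ b ] [ d ] ⟩
      [ a ] + [ d ]                     ≡⟨ []-+ a d ⟨
      [ a ℕ.+ d ]                       ≡⟨ cong [_] (ℤ.+-injective ℕ-eq) ⟩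
      [ c ℕ.+ b ]                       ≡⟨ []-+ c b ⟩
      [ c ] + [ b ]                     ≡⟨ shuffle [ c ] [ d ] [ b ] ⟨
      ([ c ] − [ d ]) + ([ d ] + [ b ]) ≡⟨ cong (([ c ] − [ d ]) +_) (+-comm [ d ] [ b ]) ⟩
      ([ c ] − [ d ]) + ([ b ] + [ d ]) ∎)
      where
      shuffle : ∀ x y z → (x − y) + (y + z) ≡ x + z
      shuffle x y z = trans (cong (_+ (y + z)) (+-comm x (- y))) (trans (interchange (- y) x y z) (trans (cong (_+ (x + z)) (-‿inverseˡ y)) (+-identityˡ (x + z))))
      ℤ-shuffle : ∀ x y z → x ℤ.+ z ≡ (x ℤ.- y) ℤ.+ (y ℤ.+ z)
      ℤ-shuffle = solve-∀
      ℕ-eq : ⁺ (a ℕ.+ d) ≡ ⁺ (c ℕ.+ b)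
      ℕ-eq = begin
        ⁺ (a ℕ.+ d)                     ≡⟨ ℤ.pos-+ a d ⟩
        ⁺ a ℤ.+ ⁺ d                     ≡⟨ ℤ-shuffle (⁺ a) (⁺ b) (⁺ d) ⟩
        (⁺ a ℤ.- ⁺ b) ℤ.+ (⁺ b ℤ.+ ⁺ d) ≡⟨ cong₂ ℤ._+_ e (ℤ.+-comm (⁺ b) (⁺ d)) ⟩
        (⁺ c ℤ.- ⁺ d) ℤ.+ (⁺ d ℤ.+ ⁺ b) ≡⟨ ℤ-shuffle (⁺ c) (⁺ d) (⁺ b) ⟨
        ⁺ c ℤ.+ ⁺ b                     ≡⟨ ℤ.pos-+ c b ⟨
        ⁺ (c ℕ.+ b)                     ∎

    ι-diff : ∀ a b → ι (⁺ a ℤ.- ⁺ b) ≡ [ a ] − [ b ]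
    ι-diff a b = sym (ι-welldefined a b _ _ (pos−neg (⁺ a ℤ.- ⁺ b)))

  -- ι is a ring homomorphism: write each integer as z⁺ − z⁻ and compute in ℕ
  ι-+ : ∀ x y → ι (x ℤ.+ y) ≡ ι x + ι y
  ι-+ x y = begin
    ι (x ℤ.+ y)                                     ≡⟨ cong ι split ⟩
    ι (⁺ (x⁺ ℕ.+ y⁺) ℤ.- ⁺ (x⁻ ℕ.+ y⁻))             ≡⟨ ι-diff (x⁺ ℕ.+ y⁺) (x⁻ ℕ.+ y⁻) ⟩
    [ x⁺ ℕ.+ y⁺ ] − [ x⁻ ℕ.+ y⁻ ]                   ≡⟨ cong₂ _−_ ([]-+ x⁺ y⁺) ([]-+ x⁻ y⁻) ⟩
    ([ x⁺ ] + [ y⁺ ]) − ([ x⁻ ] + [ y⁻ ])           ≡⟨ −-+ [ x⁺ ] [ x⁻ ] [ y⁺ ] [ y⁻ ] ⟨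
    ι x + ι y                                       ∎
    where
    x⁺ x⁻ y⁺ y⁻ : ℕ
    x⁺ = pos x
    x⁻ = neg x
    y⁺ = pos y
    y⁻ = neg y
    ℤ-identity : ∀ a b c d → (a ℤ.- b) ℤ.+ (c ℤ.- d) ≡ (a ℤ.+ c) ℤ.- (b ℤ.+ d)
    ℤ-identity = solve-∀
    split : x ℤ.+ y ≡ ⁺ (x⁺ ℕ.+ y⁺) ℤ.- ⁺ (x⁻ ℕ.+ y⁻)
    split = trans (cong₂ ℤ._+_ (pos−neg x) (pos−neg y)) (trans (ℤ-identity (⁺ x⁺) (⁺ x⁻) (⁺ y⁺) (⁺ y⁻))
              (sym (cong₂ ℤ._-_ (ℤ.pos-+ x⁺ y⁺) (ℤ.pos-+ x⁻ y⁻))))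

  ι-* : ∀ x y → ι (x ℤ.* y) ≡ ι x * ι y
  ι-* x y = begin
    ι (x ℤ.* y)                                                       ≡⟨ cong ι split ⟩
    ι (⁺ (x⁺ ℕ.* y⁺ ℕ.+ x⁻ ℕ.* y⁻) ℤ.- ⁺ (x⁺ ℕ.* y⁻ ℕ.+ x⁻ ℕ.* y⁺))   ≡⟨ ι-diff _ _ ⟩
    [ x⁺ ℕ.* y⁺ ℕ.+ x⁻ ℕ.* y⁻ ] − [ x⁺ ℕ.* y⁻ ℕ.+ x⁻ ℕ.* y⁺ ]         ≡⟨ cong₂ _−_ (reduce x⁺ y⁺ x⁻ y⁻) (reduce x⁺ y⁻ x⁻ y⁺) ⟩
    ([ x⁺ ] * [ y⁺ ] + [ x⁻ ] * [ y⁻ ]) − ([ x⁺ ] * [ y⁻ ] + [ x⁻ ] * [ y⁺ ]) ≡⟨ −-* [ x⁺ ] [ x⁻ ] [ y⁺ ] [ y⁻ ] ⟨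
    ι x * ι y                                                         ∎
    where
    x⁺ x⁻ y⁺ y⁻ : ℕ
    x⁺ = pos x
    x⁻ = neg x
    y⁺ = pos y
    y⁻ = neg y
    reduce : ∀ a b c d → [ a ℕ.* b ℕ.+ c ℕ.* d ] ≡ [ a ] * [ b ] + [ c ] * [ d ]
    reduce a b c d = trans ([]-+ (a ℕ.* b) (c ℕ.* d)) (cong₂ _+_ ([]-* a b) ([]-* c d))
    ℤ-identity : ∀ a b c d → (a ℤ.- b) ℤ.* (c ℤ.- d) ≡ (a ℤ.* c ℤ.+ b ℤ.* d) ℤ.- (a ℤ.* d ℤ.+ b ℤ.* c)
    ℤ-identity = solve-∀
    pos-*+* : ∀ a b c d → ⁺ (a ℕ.* b ℕ.+ c ℕ.* d) ≡ ⁺ a ℤ.* ⁺ b ℤ.+ ⁺ c ℤ.* ⁺ d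
    pos-*+* a b c d = trans (ℤ.pos-+ (a ℕ.* b) (c ℕ.* d)) (cong₂ ℤ._+_ (ℤ.pos-* a b) (ℤ.pos-* c d))
    split : x ℤ.* y ≡ ⁺ (x⁺ ℕ.* y⁺ ℕ.+ x⁻ ℕ.* y⁻) ℤ.- ⁺ (x⁺ ℕ.* y⁻ ℕ.+ x⁻ ℕ.* y⁺)
    split = trans (cong₂ ℤ._*_ (pos−neg x) (pos−neg y)) (trans (ℤ-identity (⁺ x⁺) (⁺ x⁻) (⁺ y⁺) (⁺ y⁻))
              (sym (cong₂ ℤ._-_ (pos-*+* x⁺ y⁺ x⁻ y⁻) (pos-*+* x⁺ y⁻ x⁻ y⁺))))

  ι-neg : ∀ x → ι (ℤ.- x) ≡ - ι x
  ι-neg x = begin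
    ι (ℤ.- x)                 ≡⟨ cong ι (trans (cong ℤ.-_ (pos−neg x)) (ℤ-identity (⁺ pos x) (⁺ neg x))) ⟩
    ι (⁺ neg x ℤ.- ⁺ pos x)   ≡⟨ ι-diff (neg x) (pos x) ⟩
    [ neg x ] − [ pos x ]     ≡⟨ −-neg [ pos x ] [ neg x ] ⟨
    - ι x                     ∎
    where
    ℤ-identity : ∀ a b → ℤ.- (a ℤ.- b) ≡ b ℤ.- a
    ℤ-identity = solve-∀

  -- ι with 0 and 1 sent definitionally to 𝟘 and 𝟙, so that solver constants
  -- con (⁺ 0) and con (⁺ 1) are read back as 𝟘 and 𝟙
  ι′ : ℤ → Fp
  ι′ (⁺ 0) = 𝟘
  ι′ (⁺ 1) = 𝟙
  ι′ z = ι z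

  ι′≡ι : ∀ z → ι′ z ≡ ι z
  ι′≡ι (⁺ 0) = sym (-‿inverseʳ 𝟘)
  ι′≡ι (⁺ 1) = sym (trans (cong (𝟙 +_) ε⁻¹≈ε) (+-identityʳ 𝟙))
  ι′≡ι (⁺ suc (suc n)) = refl
  ι′≡ι -[1+ n ] = refl

  Fp-almostCommutativeRing : ACR.AlmostCommutativeRing _ _
  Fp-almostCommutativeRing = ACR.fromCommutativeRing Fp-commutativeRing

  ι′-homomorphism : ℤ.+-*-rawRing ACR.-Raw-AlmostCommutative⟶ Fp-almostCommutativeRing
  ι′-homomorphism = record
    { ⟦_⟧ = ι′
    ; +-homo = λ x y → trans (ι′≡ι (x ℤ.+ y)) (trans (ι-+ x y) (sym (cong₂ _+_ (ι′≡ι x) (ι′≡ι y))))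
    ; *-homo = λ x y → trans (ι′≡ι (x ℤ.* y)) (trans (ι-* x y) (sym (cong₂ _*_ (ι′≡ι x) (ι′≡ι y))))
    ; -‿homo = λ x → trans (ι′≡ι (ℤ.- x)) (trans (ι-neg x) (sym (cong -_ (ι′≡ι x))))
    ; 0-homo = refl
    ; 1-homo = refl }

  ι′-equal? : ∀ x y → Maybe (ι′ x ≡ ι′ y)
  ι′-equal? x y with x ℤ.≟ y
  ... | yes e = just (cong ι′ e)
  ... | no _ = nothing

  open import Algebra.Solver.Ring ℤ.+-*-rawRing Fp-almostCommutativeRing ι′-homomorphism ι′-equal? public
    using (solve; _:=_; _:+_; _:*_; :-_; _:-_; con; Polynomial)

  :𝟘 :𝟙 :𝟚 : ∀ {n} → Polynomial n
  :𝟘 = con (⁺ 0)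
  :𝟙 = con (⁺ 1)
  :𝟚 = :𝟙 :+ :𝟙

module MatrixAlgebra (p : ℕ) .{{_ : NonZero p}} where

  open ResidueRing p
  open ≡-Reasoning

  M : Set
  M = Mat p

  infixl 7 _·_
  _·_ : M → M → M
  _·_ = _*M_ p

  I : M
  I = 1M p

  mat-cong : ∀ {a₁ a₂ b₁ b₂ c₁ c₂ d₁ d₂ : Fp} → a₁ ≡ a₂ → b₁ ≡ b₂ → c₁ ≡ c₂ → d₁ ≡ d₂ →
             mat {p} a₁ b₁ c₁ d₁ ≡ mat a₂ b₂ c₂ d₂
  mat-cong refl refl refl refl = refl

  ·-assoc : ∀ m n o → m · n · o ≡ m · (n · o)
  ·-assoc m n o = mat-cong (entry (a m) (b m) (a o) (c o)) (entry (a m) (b m) (b o) (d o))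
                           (entry (c m) (d m) (a o) (c o)) (entry (c m) (d m) (b o) (d o))
    where
    entry : ∀ x₁ x₂ z₁ z₂ → (x₁ * a n + x₂ * c n) * z₁ + (x₁ * b n + x₂ * d n) * z₂
                           ≡ x₁ * (a n * z₁ + b n * z₂) + x₂ * (c n * z₁ + d n * z₂)
    entry x₁ x₂ z₁ z₂ = solve 8 (λ x₁ x₂ y₁ y₂ y₃ y₄ z₁ z₂ →
      ((x₁ :* y₁ :+ x₂ :* y₃) :* z₁ :+ (x₁ :* y₂ :+ x₂ :* y₄) :* z₂)
        := (x₁ :* (y₁ :* z₁ :+ y₂ :* z₂) :+ x₂ :* (y₃ :* z₁ :+ y₄ :* z₂))) refl x₁ x₂ (a n) (b n) (c n) (d n) z₁ z₂

  ·-identityˡ : ∀ m → I · m ≡ m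
  ·-identityˡ m = mat-cong (unit (a m) (c m)) (unit (b m) (d m)) (unit′ (a m) (c m)) (unit′ (b m) (d m))
    where
    unit : ∀ x y → 𝟙 * x + 𝟘 * y ≡ x
    unit = solve 2 (λ x y → (:𝟙 :* x :+ :𝟘 :* y) := x) refl
    unit′ : ∀ x y → 𝟘 * x + 𝟙 * y ≡ y
    unit′ = solve 2 (λ x y → (:𝟘 :* x :+ :𝟙 :* y) := y) refl

  ·-identityʳ : ∀ m → m · I ≡ m
  ·-identityʳ m = mat-cong (unit (a m) (b m)) (unit′ (a m) (b m)) (unit (c m) (d m)) (unit′ (c m) (d m))
    where
    unit : ∀ x y → x * 𝟙 + y * 𝟘 ≡ x
    unit = solve 2 (λ x y → (x :* :𝟙 :+ y :* :𝟘) := x) refl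
    unit′ : ∀ x y → x * 𝟘 + y * 𝟙 ≡ y
    unit′ = solve 2 (λ x y → (x :* :𝟘 :+ y :* :𝟙) := y) refl

  ·-monoid : Monoid _ _
  ·-monoid = record
    { Carrier = M ; _≈_ = _≡_ ; _∙_ = _·_ ; ε = I
    ; isMonoid = record
      { isSemigroup = record { isMagma = record { isEquivalence = isEquivalence ; ∙-cong = cong₂ _·_ } ; assoc = ·-assoc }
      ; identity = ·-identityˡ , ·-identityʳ } }

  module ·-Solver = Algebra.Solver.Monoid ·-monoid
  open ·-Solver using (_⊕_; _⊜_)

  Inverses : M → M → Set
  Inverses h h' = h · h' ≡ I × h' · h ≡ I

  inverses-· : ∀ {h h' k k'} → Inverses h h' → Inverses k k' → Inverses (h · k) (k' · h')
  inverses-· {h} {h'} {k} {k'} (hh' , h'h) (kk' , k'k) = cancel h h' k k' kk' hh' , cancel k' k h' h h'h k'k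
    where
    cancel : ∀ x x' y y' → y · y' ≡ I → x · x' ≡ I → x · y · (y' · x') ≡ I
    cancel x x' y y' yy' xx' = begin
      x · y · (y' · x')  ≡⟨ ·-Solver.solve 4 (λ x y y' x' → ((x ⊕ y) ⊕ (y' ⊕ x')) ⊜ ((x ⊕ (y ⊕ y')) ⊕ x')) refl x y y' x' ⟩
      x · (y · y') · x'  ≡⟨ cong (λ z → x · z · x') yy' ⟩
      x · I · x'         ≡⟨ cong (_· x') (·-identityʳ x) ⟩
      x · x'             ≡⟨ xx' ⟩
      I                  ∎

  infix 4 _∼_
  _∼_ : M → M → Set
  m ∼ g = ∃₂ λ h h' → Inverses h h' × m ≡ h · g · h'

  ∼-refl : ∀ {m} → m ∼ m
  ∼-refl {m} = I , I , (·-identityʳ I , ·-identityʳ I) , sym (trans (·-identityʳ (I · m)) (·-identityˡ m))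

  ∼-sym : ∀ {m g} → m ∼ g → g ∼ m
  ∼-sym {m} {g} (h , h' , (hh' , h'h) , m≡) = h' , h , (h'h , hh') , (begin
    g                    ≡⟨ trans (·-identityʳ (I · g)) (·-identityˡ g) ⟨
    I · g · I            ≡⟨ cong₂ (λ u v → u · g · v) h'h h'h ⟨
    h' · h · g · (h' · h) ≡⟨ ·-Solver.solve 3 (λ h' h g → (((h' ⊕ h) ⊕ g) ⊕ (h' ⊕ h)) ⊜ ((h' ⊕ ((h ⊕ g) ⊕ h')) ⊕ h)) refl h' h g ⟩
    h' · (h · g · h') · h ≡⟨ cong (λ z → h' · z · h) m≡ ⟨
    h' · m · h           ∎)

  ∼-trans : ∀ {m g n} → m ∼ g → g ∼ n → m ∼ n
  ∼-trans {m} {g} {n} (h , h' , hinv , m≡) (k , k' , kinv , g≡) = h · k , k' · h' , inverses-· {h} {h'} {k} {k'} hinv kinv , (begin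
    m                     ≡⟨ m≡ ⟩
    h · g · h'            ≡⟨ cong (λ z → h · z · h') g≡ ⟩
    h · (k · n · k') · h' ≡⟨ ·-Solver.solve 5 (λ h k n k' h' → ((h ⊕ ((k ⊕ n) ⊕ k')) ⊕ h') ⊜ (((h ⊕ k) ⊕ n) ⊕ (k' ⊕ h'))) refl h k n k' h' ⟩
    h · k · n · (k' · h') ∎)

  Det : M → Fp
  Det m = a m * d m − b m * c m

  det≡Det : ∀ m → det p m ≡ Det m
  det≡Det m = -F≡− (a m * d m) (b m * c m)

  Det-· : ∀ m n → Det (m · n) ≡ Det m * Det n
  Det-· m n = solve 8 (λ a₁ b₁ c₁ d₁ a₂ b₂ c₂ d₂ →
    ((a₁ :* a₂ :+ b₁ :* c₂) :* (c₁ :* b₂ :+ d₁ :* d₂) :- (a₁ :* b₂ :+ b₁ :* d₂) :* (c₁ :* a₂ :+ d₁ :* c₂))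
      := ((a₁ :* d₁ :- b₁ :* c₁) :* (a₂ :* d₂ :- b₂ :* c₂))) refl (a m) (b m) (c m) (d m) (a n) (b n) (c n) (d n)

  Det-I : Det I ≡ 𝟙
  Det-I = solve 0 ((:𝟙 :* :𝟙 :- :𝟘 :* :𝟘) := :𝟙) refl

  tr : M → Fp
  tr m = a m + d m

  module Generation (S : M → Set) where

    gen-· : ∀ {x y} → Generated p S x → Generated p S y → Generated p S (x · y)
    gen-· {y = y} gen-1 gy = subst (Generated p S) (sym (·-identityˡ y)) gy
    gen-· {y = y} (gen-s {x} {z} sx gz) gy = subst (Generated p S) (sym (·-assoc x z y)) (gen-s sx (gen-· gz gy))
    gen-· {y = y} (gen-inv {x} {x'} {z} sx e₁ e₂ gz) gy =
      subst (Generated p S) (sym (·-assoc x' z y)) (gen-inv sx e₁ e₂ (gen-· gz gy))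

    gen-∈ : ∀ {x} → S x → Generated p S x
    gen-∈ {x} sx = subst (Generated p S) (·-identityʳ x) (gen-s sx gen-1)

    gen-inverse : ∀ {x x'} → S x → Inverses x x' → Generated p S x'
    gen-inverse {x} {x'} sx (xx' , x'x) = subst (Generated p S) (·-identityʳ x') (gen-inv sx xx' x'x gen-1)

module OverAField (p : ℕ) .{{_ : NonZero p}} (inv : F p → F p)
                  (inv-r : ∀ {x} → x ≢ 0F p → _*F_ p x (inv x) ≡ 1F p) (nontrivial : 1F p ≢ 0F p) where

  open ResidueRing p
  open MatrixAlgebra p
  open Generation using (gen-·; gen-∈; gen-inverse)
  open ≡-Reasoning

  inv-l : ∀ {x} → x ≢ 𝟘 → inv x * x ≡ 𝟙
  inv-l {x} x≢𝟘 = trans (*-comm (inv x) x) (inv-r x≢𝟘)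

  zero-product : ∀ {z k} → k ≢ 𝟘 → z * k ≡ 𝟘 → z ≡ 𝟘
  zero-product {z} {k} k≢𝟘 zk≡𝟘 = begin
    z                 ≡⟨ *-identityʳ z ⟨
    z * 𝟙             ≡⟨ cong (z *_) (inv-r k≢𝟘) ⟨
    z * (k * inv k)   ≡⟨ *-assoc z k (inv k) ⟨
    z * k * inv k     ≡⟨ cong (_* inv k) zk≡𝟘 ⟩
    𝟘 * inv k         ≡⟨ solve 1 (λ w → (:𝟘 :* w) := :𝟘) refl (inv k) ⟩
    𝟘                 ∎

  *-≢𝟘 : ∀ {x y} → x ≢ 𝟘 → y ≢ 𝟘 → x * y ≢ 𝟘
  *-≢𝟘 x≢𝟘 y≢𝟘 xy≡𝟘 = x≢𝟘 (zero-product y≢𝟘 xy≡𝟘)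

  inv-≢𝟘 : ∀ {x} → x ≢ 𝟘 → inv x ≢ 𝟘
  inv-≢𝟘 {x} x≢𝟘 inv≡𝟘 = x≢𝟘 (zero-product x≢𝟘 (begin
    x * x             ≡⟨ *-identityˡ (x * x) ⟨
    𝟙 * (x * x)       ≡⟨ cong (λ z → z * (x * x)) (inv-r x≢𝟘) ⟨
    x * inv x * (x * x) ≡⟨ cong (λ z → x * z * (x * x)) inv≡𝟘 ⟩
    x * 𝟘 * (x * x)   ≡⟨ solve 1 (λ x → (x :* :𝟘 :* (x :* x)) := :𝟘) refl x ⟩
    𝟘                 ∎))

  *-cancelʳ : ∀ {x y k} → k ≢ 𝟘 → x * k ≡ y * k → x ≡ y
  *-cancelʳ {x} {y} {k} k≢𝟘 e = −≡𝟘⇒≡ (zero-product k≢𝟘 (begin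
    (x − y) * k       ≡⟨ solve 3 (λ x y k → ((x :- y) :* k) := (x :* k :- y :* k)) refl x y k ⟩
    x * k − y * k     ≡⟨ cong (_− y * k) e ⟩
    y * k − y * k     ≡⟨ -‿inverseʳ (y * k) ⟩
    𝟘                 ∎))

  adj : M → M
  adj m = mat (d m * k) (- b m * k) (- c m * k) (a m * k)
    where
    k : Fp
    k = inv (Det m)

  adj-inverse : ∀ m → Det m ≢ 𝟘 → Inverses m (adj m)
  adj-inverse m Det≢𝟘 =
    mat-cong (unit (solve 5 (λ a b c d k → (a :* (d :* k) :+ b :* (:- c :* k)) := ((a :* d :- b :* c) :* k)) refl x y z w k))
             (solve 5 (λ a b c d k → (a :* (:- b :* k) :+ b :* (a :* k)) := :𝟘) refl x y z w k)
             (solve 5 (λ a b c d k → (c :* (d :* k) :+ d :* (:- c :* k)) := :𝟘) refl x y z w k)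
             (unit (solve 5 (λ a b c d k → (c :* (:- b :* k) :+ d :* (a :* k)) := ((a :* d :- b :* c) :* k)) refl x y z w k)) ,
    mat-cong (unit (solve 5 (λ a b c d k → (d :* k :* a :+ (:- b :* k) :* c) := ((a :* d :- b :* c) :* k)) refl x y z w k))
             (solve 5 (λ a b c d k → (d :* k :* b :+ (:- b :* k) :* d) := :𝟘) refl x y z w k)
             (solve 5 (λ a b c d k → ((:- c :* k) :* a :+ a :* k :* c) := :𝟘) refl x y z w k)
             (unit (solve 5 (λ a b c d k → ((:- c :* k) :* b :+ a :* k :* d) := ((a :* d :- b :* c) :* k)) refl x y z w k))
    where
    x y z w k : Fp
    x = a m
    y = b m
    z = c m
    w = d m
    k = inv (Det m)
    unit : ∀ {e} → e ≡ Det m * k → e ≡ 𝟙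
    unit e = trans e (inv-r Det≢𝟘)

  companion : Fp → Fp → M
  companion t n = mat 𝟘 (- n) 𝟙 t

  -- For c m ≠ 0 the vectors e₁, m e₁ form a basis, and in it m becomes the
  -- companion matrix of its characteristic polynomial: m · Hₘ = Hₘ · C with
  -- Hₘ = (e₁ | m e₁).
  basis : M → M
  basis m = mat 𝟙 (a m) 𝟘 (c m)

  basis⁻¹ : M → M
  basis⁻¹ m = mat 𝟙 (- (a m * inv (c m))) 𝟘 (inv (c m))

  basis-intertwines : ∀ m → m · basis m ≡ basis m · companion (tr m) (Det m)
  basis-intertwines m = mat-cong
    (solve 4 (λ x y z w → (x :* :𝟙 :+ y :* :𝟘) := (:𝟙 :* :𝟘 :+ x :* :𝟙)) refl (a m) (b m) (c m) (d m))
    (solve 4 (λ x y z w → (x :* x :+ y :* z) := (:𝟙 :* (:- (x :* w :- y :* z)) :+ x :* (x :+ w))) refl (a m) (b m) (c m) (d m))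
    (solve 4 (λ x y z w → (z :* :𝟙 :+ w :* :𝟘) := (:𝟘 :* :𝟘 :+ z :* :𝟙)) refl (a m) (b m) (c m) (d m))
    (solve 4 (λ x y z w → (z :* x :+ w :* z) := (:𝟘 :* (:- (x :* w :- y :* z)) :+ z :* (x :+ w))) refl (a m) (b m) (c m) (d m))

  basis-inverse : ∀ m → c m ≢ 𝟘 → Inverses (basis m) (basis⁻¹ m)
  basis-inverse m c≢𝟘 =
    mat-cong (solve 1 (λ x → (:𝟙 :* :𝟙 :+ x :* :𝟘) := :𝟙) refl x)
             (solve 2 (λ x i → (:𝟙 :* (:- (x :* i)) :+ x :* i) := :𝟘) refl x i)
             (solve 1 (λ z → (:𝟘 :* :𝟙 :+ z :* :𝟘) := :𝟘) refl z)
             (trans (solve 3 (λ x z i → (:𝟘 :* (:- (x :* i)) :+ z :* i) := (z :* i)) refl x z i) (inv-r c≢𝟘)) ,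
    mat-cong (solve 2 (λ x i → (:𝟙 :* :𝟙 :+ (:- (x :* i)) :* :𝟘) := :𝟙) refl x i)
             (trans (solve 3 (λ x z i → (:𝟙 :* x :+ (:- (x :* i)) :* z) := (x :- x :* (i :* z))) refl x z i)
               (trans (cong (λ e → x − x * e) (inv-l c≢𝟘)) (solve 1 (λ x → (x :- x :* :𝟙) := :𝟘) refl x)))
             (solve 1 (λ i → (:𝟘 :* :𝟙 :+ i :* :𝟘) := :𝟘) refl i)
             (trans (solve 3 (λ x z i → (:𝟘 :* x :+ i :* z) := (i :* z)) refl x z i) (inv-l c≢𝟘))
    where
    x z i : Fp
    x = a m
    z = c m
    i = inv (c m)

  ∼-companion : ∀ m → c m ≢ 𝟘 → m ∼ companion (tr m) (Det m)
  ∼-companion m c≢𝟘 = basis m , basis⁻¹ m , H-inverse , (begin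
    m                             ≡⟨ ·-identityʳ m ⟨
    m · I                         ≡⟨ cong (m ·_) (proj₁ H-inverse) ⟨
    m · (basis m · basis⁻¹ m)     ≡⟨ ·-assoc m (basis m) (basis⁻¹ m) ⟨
    m · basis m · basis⁻¹ m       ≡⟨ cong (_· basis⁻¹ m) (basis-intertwines m) ⟩
    basis m · C · basis⁻¹ m       ∎)
    where
    C : M
    C = companion (tr m) (Det m)
    H-inverse : Inverses (basis m) (basis⁻¹ m)
    H-inverse = basis-inverse m c≢𝟘

  same-tr-Det⇒∼ : ∀ {m g} → c m ≢ 𝟘 → c g ≢ 𝟘 → tr m ≡ tr g → Det m ≡ Det g → m ∼ g
  same-tr-Det⇒∼ {m} {g} cm≢𝟘 cg≢𝟘 tr≡ Det≡ =
    ∼-trans (∼-companion m cm≢𝟘) (subst₂ (λ t n → companion t n ∼ g) (sym tr≡) (sym Det≡) (∼-sym (∼-companion g cg≢𝟘)))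

  lower upper : Fp → M
  lower x = mat 𝟙 𝟘 x 𝟙
  upper x = mat 𝟙 x 𝟘 𝟙

  lower-+ : ∀ x y → lower x · lower y ≡ lower (x + y)
  lower-+ x y = mat-cong (solve 1 (λ y → (:𝟙 :* :𝟙 :+ :𝟘 :* y) := :𝟙) refl y)
                         (solve 0 ((:𝟙 :* :𝟘 :+ :𝟘 :* :𝟙) := :𝟘) refl)
                         (solve 2 (λ x y → (x :* :𝟙 :+ :𝟙 :* y) := (x :+ y)) refl x y)
                         (solve 1 (λ x → (x :* :𝟘 :+ :𝟙 :* :𝟙) := :𝟙) refl x)

  upper-lower-upper : ∀ m → Det m ≡ 𝟙 → c m ≢ 𝟘 →
                      upper ((a m − 𝟙) * inv (c m)) · (lower (c m) · upper ((d m − 𝟙) * inv (c m))) ≡ m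
  upper-lower-upper m Det≡𝟙 c≢𝟘 = mat-cong
    (begin
      𝟙 * (𝟙 * 𝟙 + 𝟘 * 𝟘) + (x − 𝟙) * k * (z * 𝟙 + 𝟙 * 𝟘)
        ≡⟨ solve 3 (λ x z k → (:𝟙 :* (:𝟙 :* :𝟙 :+ :𝟘 :* :𝟘) :+ (x :- :𝟙) :* k :* (z :* :𝟙 :+ :𝟙 :* :𝟘)) := (:𝟙 :+ (x :- :𝟙) :* (k :* z))) refl x z k ⟩
      𝟙 + (x − 𝟙) * (k * z)   ≡⟨ cong (λ e → 𝟙 + (x − 𝟙) * e) kz≡𝟙 ⟩
      𝟙 + (x − 𝟙) * 𝟙         ≡⟨ solve 1 (λ x → (:𝟙 :+ (x :- :𝟙) :* :𝟙) := x) refl x ⟩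
      x                       ∎)
    (begin
      𝟙 * (𝟙 * ((w − 𝟙) * k) + 𝟘 * 𝟙) + (x − 𝟙) * k * (z * ((w − 𝟙) * k) + 𝟙 * 𝟙)
        ≡⟨ solve 4 (λ x w z k → (:𝟙 :* (:𝟙 :* ((w :- :𝟙) :* k) :+ :𝟘 :* :𝟙) :+ (x :- :𝟙) :* k :* (z :* ((w :- :𝟙) :* k) :+ :𝟙 :* :𝟙))
              := ((x :- :𝟙 :+ (w :- :𝟙) :+ (x :- :𝟙) :* (w :- :𝟙) :* (k :* z)) :* k)) refl x w z k ⟩
      (x − 𝟙 + (w − 𝟙) + (x − 𝟙) * (w − 𝟙) * (k * z)) * k ≡⟨ cong (λ e → (x − 𝟙 + (w − 𝟙) + (x − 𝟙) * (w − 𝟙) * e) * k) kz≡𝟙 ⟩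
      (x − 𝟙 + (w − 𝟙) + (x − 𝟙) * (w − 𝟙) * 𝟙) * k
        ≡⟨ solve 5 (λ x y z w k → ((x :- :𝟙 :+ (w :- :𝟙) :+ (x :- :𝟙) :* (w :- :𝟙) :* :𝟙) :* k) := (y :* (z :* k) :+ ((x :* w :- y :* z) :- :𝟙) :* k)) refl x y z w k ⟩
      y * (z * k) + (Det m − 𝟙) * k   ≡⟨ cong₂ (λ e f → y * e + (f − 𝟙) * k) (trans (*-comm z k) kz≡𝟙) Det≡𝟙 ⟩
      y * 𝟙 + (𝟙 − 𝟙) * k           ≡⟨ solve 2 (λ y k → (y :* :𝟙 :+ (:𝟙 :- :𝟙) :* k) := y) refl y k ⟩
      y                             ∎)
    (solve 2 (λ z k → (:𝟘 :* (:𝟙 :* :𝟙 :+ :𝟘 :* :𝟘) :+ :𝟙 :* (z :* :𝟙 :+ :𝟙 :* :𝟘)) := z) refl z k)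
    (begin
      𝟘 * (𝟙 * ((w − 𝟙) * k) + 𝟘 * 𝟙) + 𝟙 * (z * ((w − 𝟙) * k) + 𝟙 * 𝟙)
        ≡⟨ solve 3 (λ w z k → (:𝟘 :* (:𝟙 :* ((w :- :𝟙) :* k) :+ :𝟘 :* :𝟙) :+ :𝟙 :* (z :* ((w :- :𝟙) :* k) :+ :𝟙 :* :𝟙)) := ((w :- :𝟙) :* (k :* z) :+ :𝟙)) refl w z k ⟩
      (w − 𝟙) * (k * z) + 𝟙   ≡⟨ cong (λ e → (w − 𝟙) * e + 𝟙) kz≡𝟙 ⟩
      (w − 𝟙) * 𝟙 + 𝟙         ≡⟨ solve 1 (λ w → ((w :- :𝟙) :* :𝟙 :+ :𝟙) := w) refl w ⟩
      w                       ∎)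
    where
    x y z w k : Fp
    x = a m
    y = b m
    z = c m
    w = d m
    k = inv (c m)
    kz≡𝟙 : k * z ≡ 𝟙
    kz≡𝟙 = inv-l c≢𝟘

  Det-lower : ∀ x → Det (lower x) ≡ 𝟙
  Det-lower = solve 1 (λ x → (:𝟙 :* :𝟙 :- :𝟘 :* x) := :𝟙) refl

  Det-upper : ∀ x → Det (upper x) ≡ 𝟙
  Det-upper = solve 1 (λ x → (:𝟙 :* :𝟙 :- x :* :𝟘) := :𝟙) refl

  module _ (S : M → Set) (gen-lower : ∀ x → Generated p S (lower x)) (gen-upper : ∀ x → Generated p S (upper x)) where

    SL₂-generated-c≢𝟘 : ∀ m → Det m ≡ 𝟙 → c m ≢ 𝟘 → Generated p S m
    SL₂-generated-c≢𝟘 m Det≡𝟙 c≢𝟘 = subst (Generated p S) (upper-lower-upper m Det≡𝟙 c≢𝟘)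
                                      (gen-· S (gen-upper α) (gen-· S (gen-lower (c m)) (gen-upper δ)))
      where
      α δ : Fp
      α = (a m − 𝟙) * inv (c m)
      δ = (d m − 𝟙) * inv (c m)

    -- SL₂(F_p) is generated by the elementary matrices: if c m = 0, then
    -- lower 1 · m has nonzero lower-left entry a m.
    SL₂-generated : ∀ m → Det m ≡ 𝟙 → Generated p S m
    SL₂-generated m Det≡𝟙 with c m Fin.≟ 𝟘
    ... | no c≢𝟘 = SL₂-generated-c≢𝟘 m Det≡𝟙 c≢𝟘
    ... | yes c≡𝟘 = subst (Generated p S) m≡ (gen-· S (gen-lower (- 𝟙)) (SL₂-generated-c≢𝟘 m′ Det-m′ c-m′≢𝟘))
      where
      m′ : M
      m′ = lower 𝟙 · m
      Det-m′ : Det m′ ≡ 𝟙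
      Det-m′ = trans (Det-· (lower 𝟙) m) (trans (cong₂ _*_ (Det-lower 𝟙) Det≡𝟙) (*-identityˡ 𝟙))
      a≢𝟘 : a m ≢ 𝟘
      a≢𝟘 a≡𝟘 = nontrivial (trans (sym Det≡𝟙) (trans (cong₂ (λ x z → x * d m − b m * z) a≡𝟘 c≡𝟘)
                      (solve 2 (λ y w → (:𝟘 :* w :- y :* :𝟘) := :𝟘) refl (b m) (d m))))
      c-m′≢𝟘 : c m′ ≢ 𝟘
      c-m′≢𝟘 e = a≢𝟘 (trans (solve 2 (λ x z → x := (:𝟙 :* x :+ :𝟙 :* z :- z)) refl (a m) (c m))
                      (trans (cong₂ _−_ e c≡𝟘) (solve 0 ((:𝟘 :- :𝟘) := :𝟘) refl)))
      m≡ : lower (- 𝟙) · m′ ≡ m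
      m≡ = begin
        lower (- 𝟙) · (lower 𝟙 · m)   ≡⟨ ·-assoc (lower (- 𝟙)) (lower 𝟙) m ⟨
        lower (- 𝟙) · lower 𝟙 · m     ≡⟨ cong (_· m) (lower-+ (- 𝟙) 𝟙) ⟩
        lower (- 𝟙 + 𝟙) · m           ≡⟨ cong (λ z → lower z · m) (-‿inverseˡ 𝟙) ⟩
        I · m                         ≡⟨ ·-identityˡ m ⟩
        m                             ∎

  quotient-generated : ∀ S {u X Y} → S X → S Y → Det Y ≢ 𝟘 → X ≡ u · Y → Generated p S u
  quotient-generated S {u} {X} {Y} SX SY Det≢𝟘 X≡uY =
    subst (Generated p S) X·Y⁻¹≡u (gen-· S (gen-∈ S SX) (gen-inverse S SY Y-inverse))
    where
    Y-inverse : Inverses Y (adj Y)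
    Y-inverse = adj-inverse Y Det≢𝟘
    X·Y⁻¹≡u : X · adj Y ≡ u
    X·Y⁻¹≡u = begin
      X · adj Y         ≡⟨ cong (_· adj Y) X≡uY ⟩
      u · Y · adj Y     ≡⟨ ·-assoc u Y (adj Y) ⟩
      u · (Y · adj Y)   ≡⟨ cong (u ·_) (proj₁ Y-inverse) ⟩
      u · I             ≡⟨ ·-identityʳ u ⟩
      u                 ∎

  -- If S contains every matrix with c ≠ 0, determinant N ≠ 0 and trace T, and
  -- likewise for trace −T, where 2T ≠ 0, then every elementary matrix x ≠ 0 is
  -- a quotient X · Y⁻¹ of two such matrices.
  module Elementary (S : M → Set) (T N : Fp) (2T≢𝟘 : T + T ≢ 𝟘) (N≢𝟘 : N ≢ 𝟘)
                    (∈S⁺ : ∀ {m} → c m ≢ 𝟘 → tr m ≡ T → Det m ≡ N → S m)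
                    (∈S⁻ : ∀ {m} → c m ≢ 𝟘 → tr m ≡ - T → Det m ≡ N → S m) where

    lower-generated : ∀ x → Generated p S (lower x)
    lower-generated x with x Fin.≟ 𝟘
    ... | yes refl = gen-1
    ... | no x≢𝟘 = quotient-generated S {lower x} {lower x · Y} {Y} X∈S Y∈S Det-Y≢𝟘 refl
      where
      bY cY : Fp
      bY = (T + T) * inv x
      cY = - (N * inv bY)
      bY≢𝟘 : bY ≢ 𝟘
      bY≢𝟘 = *-≢𝟘 2T≢𝟘 (inv-≢𝟘 x≢𝟘)
      cY≢𝟘 : cY ≢ 𝟘
      cY≢𝟘 = -≢𝟘 (*-≢𝟘 N≢𝟘 (inv-≢𝟘 bY≢𝟘))
      Y : M
      Y = mat 𝟘 bY cY (- T)
      Det-Y : Det Y ≡ N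
      Det-Y = trans (solve 4 (λ b n i t → (:𝟘 :* (:- t) :- b :* (:- (n :* i))) := (n :* (b :* i))) refl bY N (inv bY) T)
                    (trans (cong (N *_) (inv-r bY≢𝟘)) (*-identityʳ N))
      Det-Y≢𝟘 : Det Y ≢ 𝟘
      Det-Y≢𝟘 e = N≢𝟘 (trans (sym Det-Y) e)
      Y∈S : S Y
      Y∈S = ∈S⁻ cY≢𝟘 (+-identityˡ (- T)) Det-Y
      tr-X : tr (lower x · Y) ≡ T
      tr-X = begin
        (𝟙 * 𝟘 + 𝟘 * cY) + (x * ((T + T) * inv x) + 𝟙 * - T)
          ≡⟨ solve 4 (λ t x i c → ((:𝟙 :* :𝟘 :+ :𝟘 :* c) :+ (x :* ((t :+ t) :* i) :+ :𝟙 :* (:- t))) := ((t :+ t) :* (x :* i) :- t)) refl T x (inv x) cY ⟩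
        (T + T) * (x * inv x) − T   ≡⟨ cong (λ z → (T + T) * z − T) (inv-r x≢𝟘) ⟩
        (T + T) * 𝟙 − T             ≡⟨ solve 1 (λ t → ((t :+ t) :* :𝟙 :- t) := t) refl T ⟩
        T                           ∎
      c-X : c (lower x · Y) ≡ cY
      c-X = solve 2 (λ x c → (x :* :𝟘 :+ :𝟙 :* c) := c) refl x cY
      X∈S : S (lower x · Y)
      X∈S = ∈S⁺ (λ e → cY≢𝟘 (trans (sym c-X) e)) tr-X
                (trans (Det-· (lower x) Y) (trans (cong₂ _*_ (Det-lower x) Det-Y) (*-identityˡ N)))

    upper-generated : ∀ x → Generated p S (upper x)
    upper-generated x with x Fin.≟ 𝟘
    ... | yes refl = gen-1
    ... | no x≢𝟘 = quotient-generated S {upper x} {upper x · Y} {Y} X∈S Y∈S Det-Y≢𝟘 refl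
      where
      bY cY : Fp
      cY = (T + T) * inv x
      bY = - (N * inv cY)
      cY≢𝟘 : cY ≢ 𝟘
      cY≢𝟘 = *-≢𝟘 2T≢𝟘 (inv-≢𝟘 x≢𝟘)
      Y : M
      Y = mat (- T) bY cY 𝟘
      Det-Y : Det Y ≡ N
      Det-Y = trans (solve 4 (λ c n i t → ((:- t) :* :𝟘 :- (:- (n :* i)) :* c) := (n :* (i :* c))) refl cY N (inv cY) T)
                    (trans (cong (N *_) (inv-l cY≢𝟘)) (*-identityʳ N))
      Det-Y≢𝟘 : Det Y ≢ 𝟘
      Det-Y≢𝟘 e = N≢𝟘 (trans (sym Det-Y) e)
      Y∈S : S Y
      Y∈S = ∈S⁻ cY≢𝟘 (+-identityʳ (- T)) Det-Y
      tr-X : tr (upper x · Y) ≡ T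
      tr-X = begin
        (𝟙 * - T + x * ((T + T) * inv x)) + (𝟘 * bY + 𝟙 * 𝟘)
          ≡⟨ solve 4 (λ t x i b → ((:𝟙 :* (:- t) :+ x :* ((t :+ t) :* i)) :+ (:𝟘 :* b :+ :𝟙 :* :𝟘)) := ((t :+ t) :* (x :* i) :- t)) refl T x (inv x) bY ⟩
        (T + T) * (x * inv x) − T   ≡⟨ cong (λ z → (T + T) * z − T) (inv-r x≢𝟘) ⟩
        (T + T) * 𝟙 − T             ≡⟨ solve 1 (λ t → ((t :+ t) :* :𝟙 :- t) := t) refl T ⟩
        T                           ∎
      c-X : c (upper x · Y) ≡ cY
      c-X = solve 2 (λ t c → (:𝟘 :* (:- t) :+ :𝟙 :* c) := c) refl T cY
      X∈S : S (upper x · Y)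
      X∈S = ∈S⁺ (λ e → cY≢𝟘 (trans (sym c-X) e)) tr-X
                (trans (Det-· (upper x) Y) (trans (cong₂ _*_ (Det-upper x) Det-Y) (*-identityˡ N)))

  private
    h : ℕ
    h = ⌊ p /2⌋

    h<p : h ℕ.< p
    h<p = ⌊n/2⌋<n (ℕ.n≢0⇒n>0 (ℕ.≢-nonZero⁻¹ p))

  square-injective : ∀ {x y} → x ℕ.≤ h → y ℕ.≤ h → [ x ] * [ x ] ≡ [ y ] * [ y ] → x ≡ y
  square-injective {x} {y} x≤h y≤h e with [ x ] Fin.≟ [ y ]
  ... | yes [x]≡[y] = []-injective (ℕ.≤-<-trans x≤h h<p) (ℕ.≤-<-trans y≤h h<p) [x]≡[y]
  ... | no [x]≢[y] with x ℕ.+ y ℕ.<? p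
  ...   | yes x+y<p = trans (ℕ.m+n≡0⇒m≡0 x x+y≡0) (sym (ℕ.m+n≡0⇒n≡0 x x+y≡0))
    where
    x+y≡0 : x ℕ.+ y ≡ 0
    x+y≡0 = []-injective x+y<p (ℕ.≤-<-trans ℕ.z≤n h<p) (trans ([]-+ x y) sum≡𝟘)
      where
      X Y : Fp
      X = [ x ]
      Y = [ y ]
      sum≡𝟘 : X + Y ≡ 𝟘
      sum≡𝟘 = zero-product (λ X−Y≡𝟘 → [x]≢[y] (−≡𝟘⇒≡ X−Y≡𝟘)) (begin
        (X + Y) * (X − Y)   ≡⟨ solve 2 (λ x y → ((x :+ y) :* (x :- y)) := (x :* x :- y :* y)) refl X Y ⟩
        X * X − Y * Y       ≡⟨ cong (_− Y * Y) e ⟩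
        Y * Y − Y * Y       ≡⟨ -‿inverseʳ (Y * Y) ⟩
        𝟘                   ∎)
  ...   | no x+y≮p = trans (both-maximal x≤h y≤h 2h≤x+y) (sym (both-maximal y≤h x≤h (subst (h ℕ.+ h ℕ.≤_) (ℕ.+-comm x y) 2h≤x+y)))
    where
    2h≤x+y : h ℕ.+ h ℕ.≤ x ℕ.+ y
    2h≤x+y = ℕ.≤-trans (proj₁ (⌊n/2⌋-bounds p)) (ℕ.≮⇒≥ x+y≮p)


  -- Every α + β Y² (β ≠ 0) can be made a square: the p + 1 values X² and
  -- α + β Y² for 0 ≤ X, Y ≤ ⌊p/2⌋ cannot all be distinct.
  squares-meet : ∀ α β → β ≢ 𝟘 → ∃₂ λ X Y → X * X ≡ α + β * (Y * Y)
  squares-meet α β β≢𝟘 = [ toℕ i ] , [ toℕ j ] , e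
    where
    square shifted : Fin (suc h) → Fp
    square j = [ toℕ j ] * [ toℕ j ]
    shifted j = α + β * square j
    square-inj : Injective _≡_ _≡_ square
    square-inj {i} {j} e = toℕ-injective (square-injective (ℕ.≤-pred (toℕ<n i)) (ℕ.≤-pred (toℕ<n j)) e)
    shifted-inj : Injective _≡_ _≡_ shifted
    shifted-inj {i} {j} e = square-inj (*-cancelʳ β≢𝟘 (trans (*-comm (square i) β)
      (trans (cancelʳ α (trans (+-comm (β * square i) α) (trans e (+-comm α (β * square j))))) (*-comm β (square j)))))
    collision : ∃₂ λ i j → square i ≡ shifted j
    collision = images-meet square shifted square-inj shifted-inj (proj₂ (⌊n/2⌋-bounds p))
    i j : Fin (suc h)
    i = proj₁ collision
    j = proj₁ (proj₂ collision)
    e : square i ≡ shifted j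
    e = proj₂ (proj₂ collision)

module Cartan (p : ℕ) .{{_ : NonZero p}} (5≤p : 5 ℕ.≤ p) (G : Mat p → Set) (cartan : IsNonSplitCartan p G) where

  open ResidueRing p
  open MatrixAlgebra p
  open ≡-Reasoning

  A : M → Set
  A = proj₁ cartan

  module A-subalgebra = IsSubalgebra (proj₁ (proj₂ cartan))
  module A-field = IsFieldOfOrder (proj₁ (proj₂ (proj₂ cartan)))

  G⇔A× : ∀ g → (G g → A g × g ≢ 0M p) × (A g × g ≢ 0M p → G g)
  G⇔A× = proj₂ (proj₂ (proj₂ cartan))

  3<p : 3 ℕ.< p
  3<p = ℕ.≤-trans (ℕ.n≤1+n 4) 5≤p

  2<p : 2 ℕ.< p
  2<p = ℕ.<-trans (ℕ.n<1+n 2) 3<p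

  -- F_p is a field: a nonzero scalar x has an inverse n in A, and the first
  -- entry of x · n = I says x · a n = 1.
  scalar-inverse : ∀ {x} → x ≢ 𝟘 → ∃ λ y → x * y ≡ 𝟙
  scalar-inverse {x} x≢𝟘 with A-field.inverse (A-subalgebra.scalar∈ x) (λ e → x≢𝟘 (cong a e))
  ... | n , _ , x·n≡I = a n , trans (solve 3 (λ x y z → (x :* y) := (x :* y :+ :𝟘 :* z)) refl x (a n) (c n)) (cong a x·n≡I)

  -- the inverse in F_p, extended by inv 0 = 0
  inv : Fp → Fp
  inv x with x Fin.≟ 𝟘
  ... | yes _ = 𝟘
  ... | no x≢𝟘 = proj₁ (scalar-inverse x≢𝟘)

  inv-r : ∀ {x} → x ≢ 𝟘 → x * inv x ≡ 𝟙
  inv-r {x} x≢𝟘 with x Fin.≟ 𝟘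
  ... | yes x≡𝟘 = ⊥-elim (x≢𝟘 x≡𝟘)
  ... | no x≢𝟘 = proj₂ (scalar-inverse x≢𝟘)

  𝟙≢𝟘 : 𝟙 ≢ 𝟘
  𝟙≢𝟘 = one≢zero (ℕ.<-trans (ℕ.n<1+n 1) 2<p)

  𝟚≢𝟘 : 𝟚 ≢ 𝟘
  𝟚≢𝟘 = two≢zero 2<p

  𝟛≢𝟘 : 𝟛 ≢ 𝟘
  𝟛≢𝟘 = three≢zero 3<p

  open OverAField p inv inv-r 𝟙≢𝟘 public

  A-Det≢𝟘 : ∀ {g} → A g → g ≢ 0M p → Det g ≢ 𝟘
  A-Det≢𝟘 {g} g∈A g≢0 Det≡𝟘 with A-field.inverse g∈A g≢0
  ... | n , _ , g·n≡I = 𝟙≢𝟘 (begin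
    𝟙               ≡⟨ Det-I ⟨
    Det I           ≡⟨ cong Det g·n≡I ⟨
    Det (g · n)     ≡⟨ Det-· g n ⟩
    Det g * Det n   ≡⟨ cong (_* Det n) Det≡𝟘 ⟩
    𝟘 * Det n       ≡⟨ solve 1 (λ x → (:𝟘 :* x) := :𝟘) refl (Det n) ⟩
    𝟘               ∎)

  IsScalar : M → Set
  IsScalar m = b m ≡ 𝟘 × c m ≡ 𝟘 × a m ≡ d m

  isScalar? : ∀ m → Dec (IsScalar m)
  isScalar? m = (b m Fin.≟ 𝟘) ×-dec ((c m Fin.≟ 𝟘) ×-dec (a m Fin.≟ d m))

  -- A has p² > p elements but there are only p scalar matrices
  nonscalar : ∃ λ β → A β × ¬ IsScalar β
  nonscalar with A-field.card
  ... | L , unique , all-A , _ , length≡p² with All.all? isScalar? L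
  ...   | no ¬all-scalar = let witness = ¬All⇒Any¬ isScalar? L ¬all-scalar
                           in Any.lookup witness , All.lookupAny all-A witness
  ...   | yes all-scalar = ⊥-elim (ℕ.<⇒≱ p<p² (subst (ℕ._≤ p) length≡p² (unique-length-≤ a L unique scalar-eq)))
    where
    scalar-eq : ∀ {m n} → m ∈ L → n ∈ L → a m ≡ a n → m ≡ n
    scalar-eq m∈L n∈L a≡ with All.lookup all-scalar m∈L | All.lookup all-scalar n∈L
    ... | bm , cm , dm | bn , cn , dn = mat-cong a≡ (trans bm (sym bn)) (trans cm (sym cn)) (trans (sym dm) (trans a≡ dn))
    p<p² : p ℕ.< p ℕ.* p
    p<p² = subst (ℕ._< p ℕ.* p) (ℕ.*-identityʳ p) (ℕ.*-monoʳ-< p (ℕ.<-trans (ℕ.n<1+n 1) 2<p))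

  β : M
  β = proj₁ nonscalar

  β∈A : A β
  β∈A = proj₁ (proj₂ nonscalar)

  tβ nβ δ : Fp
  tβ = tr β
  nβ = Det β
  δ = tβ * tβ − 𝟚 * 𝟚 * nβ

  -- β − l is a nonzero element of A for every scalar l, hence invertible:
  -- the characteristic polynomial of β has no root in F_p
  char-poly-no-root : ∀ l → l * l − tβ * l + nβ ≢ 𝟘
  char-poly-no-root l χ≡𝟘 = A-Det≢𝟘 (A-subalgebra.+-closed β∈A (A-subalgebra.scalar∈ (- l))) β−l≢0
    (trans (solve 5 (λ x y z w l → ((x :+ :- l) :* (w :+ :- l) :- (y :+ :𝟘) :* (z :+ :𝟘))
                                  := (l :* l :- (x :+ w) :* l :+ (x :* w :- y :* z))) refl (a β) (b β) (c β) (d β) l) χ≡𝟘)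
    where
    β−l≢0 : _+M_ p β (scalar p (- l)) ≢ 0M p
    β−l≢0 e = proj₂ (proj₂ nonscalar)
      (trans (sym (+-identityʳ (b β))) (cong b e) , trans (sym (+-identityʳ (c β))) (cong c e) ,
       cancelʳ (- l) (trans (cong a e) (sym (cong d e))))

  c-β≢𝟘 : c β ≢ 𝟘
  c-β≢𝟘 c≡𝟘 = char-poly-no-root (a β) (begin
    a β * a β − tβ * a β + nβ   ≡⟨ solve 4 (λ x y z w → (x :* x :- (x :+ w) :* x :+ (x :* w :- y :* z)) := (:- (y :* z))) refl (a β) (b β) (c β) (d β) ⟩
    - (b β * c β)               ≡⟨ cong (λ z → - (b β * z)) c≡𝟘 ⟩
    - (b β * 𝟘)                 ≡⟨ solve 1 (λ y → (:- (y :* :𝟘)) := :𝟘) refl (b β) ⟩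
    𝟘                           ∎)

  -- δ = 0 would make tβ/2 a root
  δ≢𝟘 : δ ≢ 𝟘
  δ≢𝟘 δ≡𝟘 = char-poly-no-root (tβ * w) (zero-product (*-≢𝟘 𝟚≢𝟘 𝟚≢𝟘) (begin
    χ * (𝟚 * 𝟚)
      ≡⟨ solve 3 (λ t n w → ((t :* w) :* (t :* w) :- t :* (t :* w) :+ n) :* (:𝟚 :* :𝟚)
                           := ((:𝟚 :* w) :* (:𝟚 :* w) :* t :* t :- :𝟚 :* t :* t :* (:𝟚 :* w) :+ :𝟚 :* :𝟚 :* n)) refl tβ nβ w ⟩
    (𝟚 * w) * (𝟚 * w) * tβ * tβ − 𝟚 * tβ * tβ * (𝟚 * w) + 𝟚 * 𝟚 * nβ
      ≡⟨ cong (λ e → e * e * tβ * tβ − 𝟚 * tβ * tβ * e + 𝟚 * 𝟚 * nβ) (inv-r 𝟚≢𝟘) ⟩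
    𝟙 * 𝟙 * tβ * tβ − 𝟚 * tβ * tβ * 𝟙 + 𝟚 * 𝟚 * nβ
      ≡⟨ solve 2 (λ t n → (:𝟙 :* :𝟙 :* t :* t :- :𝟚 :* t :* t :* :𝟙 :+ :𝟚 :* :𝟚 :* n) := (:- (t :* t :- :𝟚 :* :𝟚 :* n))) refl tβ nβ ⟩
    - δ ≡⟨ cong -_ δ≡𝟘 ⟩
    - 𝟘 ≡⟨ solve 0 ((:- :𝟘) := :𝟘) refl ⟩
    𝟘   ∎))
    where
    w χ : Fp
    w = inv 𝟚
    χ = tβ * w * (tβ * w) − tβ * (tβ * w) + nβ

  el : Fp → Fp → M
  el u v = _+M_ p (scalar p u) (scalar p v · β)

  el∈A : ∀ u v → A (el u v)
  el∈A u v = A-subalgebra.+-closed (A-subalgebra.scalar∈ u) (A-subalgebra.*-closed (A-subalgebra.scalar∈ v) β∈A)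

  norm : Fp → Fp → Fp
  norm u v = u * u + u * v * tβ + v * v * nβ

  c-el : ∀ u v → c (el u v) ≡ v * c β
  c-el u v = solve 3 (λ v x z → (:𝟘 :+ (:𝟘 :* x :+ v :* z)) := (v :* z)) refl v (a β) (c β)

  tr-el : ∀ u v → tr (el u v) ≡ 𝟚 * u + v * tβ
  tr-el u v = solve 6 (λ u v x y z w → ((u :+ (v :* x :+ :𝟘 :* z)) :+ (u :+ (:𝟘 :* y :+ v :* w)))
                                     := (:𝟚 :* u :+ v :* (x :+ w))) refl u v (a β) (b β) (c β) (d β)

  Det-el : ∀ u v → Det (el u v) ≡ norm u v
  Det-el u v = solve 6 (λ u v x y z w →
    ((u :+ (v :* x :+ :𝟘 :* z)) :* (u :+ (:𝟘 :* y :+ v :* w)) :- (:𝟘 :+ (v :* y :+ :𝟘 :* w)) :* (:𝟘 :+ (:𝟘 :* x :+ v :* z)))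
      := (u :* u :+ u :* v :* (x :+ w) :+ v :* v :* (x :* w :- y :* z))) refl u v (a β) (b β) (c β) (d β)

  discriminant-el : ∀ u v → (𝟚 * u + v * tβ) * (𝟚 * u + v * tβ) − 𝟚 * 𝟚 * norm u v ≡ v * v * δ
  discriminant-el u v = solve 4 (λ u v t n →
    ((:𝟚 :* u :+ v :* t) :* (:𝟚 :* u :+ v :* t) :- :𝟚 :* :𝟚 :* (u :* u :+ u :* v :* t :+ v :* v :* n))
      := (v :* v :* (t :* t :- :𝟚 :* :𝟚 :* n))) refl u v tβ nβ

  c-el≢𝟘 : ∀ u {v} → v ≢ 𝟘 → c (el u v) ≢ 𝟘
  c-el≢𝟘 u {v} v≢𝟘 e = *-≢𝟘 v≢𝟘 c-β≢𝟘 (trans (sym (c-el u v)) e)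

  el∈G : ∀ u v → norm u v ≢ 𝟘 → G (el u v)
  el∈G u v norm≢𝟘 = proj₂ (G⇔A× (el u v)) (el∈A u v , λ e → norm≢𝟘 (trans (sym (Det-el u v)) (trans (cong Det e) Det-0)))
    where
    Det-0 : Det (0M p) ≡ 𝟘
    Det-0 = solve 0 ((:𝟘 :* :𝟘 :- :𝟘 :* :𝟘) := :𝟘) refl

  norm≢𝟘 : ∀ u {v} → v ≢ 𝟘 → norm u v ≢ 𝟘
  norm≢𝟘 u {v} v≢𝟘 e = A-Det≢𝟘 (el∈A u v) (λ el≡0 → c-el≢𝟘 u v≢𝟘 (cong c el≡0)) (trans (Det-el u v) e)

  norm-from-square : ∀ {D X Y} → X * X ≡ 𝟚 * 𝟚 * D + δ * (Y * Y) → norm ((X − Y * tβ) * inv 𝟚) Y ≡ D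
  norm-from-square {D} {X} {Y} X²≡ = *-cancelʳ (*-≢𝟘 𝟚≢𝟘 𝟚≢𝟘) (begin
    norm u Y * (𝟚 * 𝟚)                   ≡⟨ solve 2 (λ z n → (n :* (:𝟚 :* :𝟚)) := (z :- (z :- :𝟚 :* :𝟚 :* n))) refl T² (norm u Y) ⟩
    T² − (T² − 𝟚 * 𝟚 * norm u Y)         ≡⟨ cong (T² −_) (discriminant-el u Y) ⟩
    T² − Y * Y * δ                       ≡⟨ cong (λ z → z * z − Y * Y * δ) 2u+Ytβ≡X ⟩
    X * X − Y * Y * δ                    ≡⟨ cong (_− Y * Y * δ) X²≡ ⟩
    𝟚 * 𝟚 * D + δ * (Y * Y) − Y * Y * δ  ≡⟨ solve 3 (λ d e y → (:𝟚 :* :𝟚 :* d :+ e :* (y :* y) :- y :* y :* e) := (d :* (:𝟚 :* :𝟚))) refl D δ Y ⟩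
    D * (𝟚 * 𝟚)                          ∎)
    where
    u T² : Fp
    u = (X − Y * tβ) * inv 𝟚
    T² = (𝟚 * u + Y * tβ) * (𝟚 * u + Y * tβ)
    2u+Ytβ≡X : 𝟚 * u + Y * tβ ≡ X
    2u+Ytβ≡X = begin
      𝟚 * ((X − Y * tβ) * inv 𝟚) + Y * tβ   ≡⟨ solve 4 (λ x y t w → (:𝟚 :* ((x :- y :* t) :* w) :+ y :* t) := ((x :- y :* t) :* (:𝟚 :* w) :+ y :* t)) refl X Y tβ (inv 𝟚) ⟩
      (X − Y * tβ) * (𝟚 * inv 𝟚) + Y * tβ   ≡⟨ cong (λ e → (X − Y * tβ) * e + Y * tβ) (inv-r 𝟚≢𝟘) ⟩
      (X − Y * tβ) * 𝟙 + Y * tβ             ≡⟨ solve 3 (λ x y t → ((x :- y :* t) :* :𝟙 :+ y :* t) := x) refl X Y tβ ⟩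
      X                                     ∎

  norm-surjective : ∀ D → ∃₂ λ u v → norm u v ≡ D
  norm-surjective D = solution (squares-meet (𝟚 * 𝟚 * D) δ δ≢𝟘)
    where
    solution : (∃₂ λ X Y → X * X ≡ 𝟚 * 𝟚 * D + δ * (Y * Y)) → ∃₂ λ u v → norm u v ≡ D
    solution (X , Y , X²≡) = (X − Y * tβ) * inv 𝟚 , Y , norm-from-square {D} {X} {Y} X²≡

module Conjugates (p : ℕ) .{{_ : NonZero p}} (5≤p : 5 ℕ.≤ p) (G : Mat p → Set) (cartan : IsNonSplitCartan p G) where

  open ResidueRing p
  open MatrixAlgebra p
  open Cartan p 5≤p G cartan
  open ≡-Reasoning

  S : M → Set
  S = ConjSet p G

  ∼G⇒∈S : ∀ {m g} → G g → m ∼ g → S m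
  ∼G⇒∈S {m} {g} g∈G (h , h' , (hh' , h'h) , m≡) = g , h , h' , g∈G , hh' , h'h , m≡

  class∈S : ∀ u {v} → v ≢ 𝟘 → ∀ {m} → c m ≢ 𝟘 → tr m ≡ 𝟚 * u + v * tβ → Det m ≡ norm u v → S m
  class∈S u {v} v≢𝟘 {m} c≢𝟘 tr≡ Det≡ = ∼G⇒∈S {m} {el u v} (el∈G u v (norm≢𝟘 u v≢𝟘))
    (same-tr-Det⇒∼ {m} {el u v} c≢𝟘 (c-el≢𝟘 u v≢𝟘) (trans tr≡ (sym (tr-el u v))) (trans Det≡ (sym (Det-el u v))))

  realise : Fp → Fp → Fp → Fp → M
  realise T N x z = mat x ((x * (T − x) − N) * inv z) z (T − x)

  tr-realise : ∀ T N x z → tr (realise T N x z) ≡ T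
  tr-realise T N x z = solve 2 (λ x t → (x :+ (t :- x)) := t) refl x T

  Det-realise : ∀ T N x {z} → z ≢ 𝟘 → Det (realise T N x z) ≡ N
  Det-realise T N x {z} z≢𝟘 = begin
    x * (T − x) − (x * (T − x) − N) * inv z * z   ≡⟨ solve 4 (λ q n k z → (q :- (q :- n) :* k :* z) := (q :- (q :- n) :* (k :* z))) refl (x * (T − x)) N (inv z) z ⟩
    x * (T − x) − (x * (T − x) − N) * (inv z * z) ≡⟨ cong (λ e → x * (T − x) − (x * (T − x) − N) * e) (inv-l z≢𝟘) ⟩
    x * (T − x) − (x * (T − x) − N) * 𝟙           ≡⟨ solve 2 (λ q n → (q :- (q :- n) :* :𝟙) := n) refl (x * (T − x)) N ⟩
    N                                             ∎

  realise-injective : ∀ {T T' N N' x z} → z ≢ 𝟘 → realise T N x z ≡ realise T' N' x z → T ≡ T' × N ≡ N'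
  realise-injective {T} {T'} {N} {N'} {x} {z} z≢𝟘 e = T≡T' , N≡N'
    where
    T≡T' : T ≡ T'
    T≡T' = cancelʳ (- x) (cong d e)
    N≡N' : N ≡ N'
    N≡N' = begin
      N                                 ≡⟨ solve 2 (λ q n → n := (q :- (q :- n))) refl (x * (T − x)) N ⟩
      x * (T − x) − (x * (T − x) − N)   ≡⟨ cong₂ (λ t r → x * (t − x) − r) T≡T' (*-cancelʳ {x * (T − x) − N} {x * (T' − x) − N'} (inv-≢𝟘 z≢𝟘) (cong b e)) ⟩
      x * (T' − x) − (x * (T' − x) − N') ≡⟨ solve 2 (λ q n → (q :- (q :- n)) := n) refl (x * (T' − x)) N' ⟩
      N'                                ∎

  -- the scalars 1 and 2 have distinct squares, so u + β and u + 2β never share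
  -- both trace and norm with each other
  σ : Fin 2 → Fp
  σ Fin.zero = 𝟙
  σ (Fin.suc Fin.zero) = 𝟚

  σ≢𝟘 : ∀ s → σ s ≢ 𝟘
  σ≢𝟘 Fin.zero = 𝟙≢𝟘
  σ≢𝟘 (Fin.suc Fin.zero) = 𝟚≢𝟘

  same-σ : ∀ s u u' → 𝟚 * u + σ s * tβ ≡ 𝟚 * u' + σ s * tβ → u ≡ u'
  same-σ s u u' tr≡ = *-cancelʳ {u} {u'} 𝟚≢𝟘 (trans (*-comm u 𝟚) (trans (cancelʳ (σ s * tβ) tr≡) (*-comm 𝟚 u')))
  discriminant-eq : ∀ s s' u u' → 𝟚 * u + σ s * tβ ≡ 𝟚 * u' + σ s' * tβ → norm u (σ s) ≡ norm u' (σ s') →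
                    σ s * σ s * δ ≡ σ s' * σ s' * δ
  discriminant-eq s s' u u' tr≡ norm≡ = begin
    σ s * σ s * δ                                                                  ≡⟨ discriminant-el u (σ s) ⟨
    (𝟚 * u + σ s * tβ) * (𝟚 * u + σ s * tβ) − 𝟚 * 𝟚 * norm u (σ s)                ≡⟨ cong₂ (λ t n → t * t − 𝟚 * 𝟚 * n) tr≡ norm≡ ⟩
    (𝟚 * u' + σ s' * tβ) * (𝟚 * u' + σ s' * tβ) − 𝟚 * 𝟚 * norm u' (σ s')          ≡⟨ discriminant-el u' (σ s') ⟩
    σ s' * σ s' * δ                                                                ∎
  distinct-squares : 𝟙 * 𝟙 * δ ≢ 𝟚 * 𝟚 * δ
  distinct-squares e = *-≢𝟘 𝟛≢𝟘 δ≢𝟘 (begin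
    𝟛 * δ                         ≡⟨ solve 1 (λ δ → ((:𝟚 :+ :𝟙) :* δ) := (:𝟚 :* :𝟚 :* δ :- :𝟙 :* :𝟙 :* δ)) refl δ ⟩
    𝟚 * 𝟚 * δ − 𝟙 * 𝟙 * δ         ≡⟨ cong (𝟚 * 𝟚 * δ −_) e ⟩
    𝟚 * 𝟚 * δ − 𝟚 * 𝟚 * δ         ≡⟨ -‿inverseʳ (𝟚 * 𝟚 * δ) ⟩
    𝟘                             ∎)

  trace-norm-injective : ∀ s s' u u' → 𝟚 * u + σ s * tβ ≡ 𝟚 * u' + σ s' * tβ → norm u (σ s) ≡ norm u' (σ s') →
                         (s , u) ≡ (s' , u')
  trace-norm-injective Fin.zero Fin.zero u u' tr≡ _ = cong (Fin.zero ,_) (same-σ Fin.zero u u' tr≡)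
  trace-norm-injective (Fin.suc Fin.zero) (Fin.suc Fin.zero) u u' tr≡ _ = cong (Fin.suc Fin.zero ,_) (same-σ (Fin.suc Fin.zero) u u' tr≡)
  trace-norm-injective Fin.zero (Fin.suc Fin.zero) u u' tr≡ norm≡ = ⊥-elim (distinct-squares (discriminant-eq Fin.zero (Fin.suc Fin.zero) u u' tr≡ norm≡))
  trace-norm-injective (Fin.suc Fin.zero) Fin.zero u u' tr≡ norm≡ = ⊥-elim (distinct-squares (sym (discriminant-eq (Fin.suc Fin.zero) Fin.zero u u' tr≡ norm≡)))

  nonzero : Fin (p ℕ.∸ 1) → Fp
  nonzero i = [ suc (toℕ i) ]

  private
    1+i<p : ∀ (i : Fin (p ℕ.∸ 1)) → suc (toℕ i) ℕ.< p
    1+i<p i = subst (suc (toℕ i) ℕ.<_) (ℕ.m+[n∸m]≡n {1} {p} (ℕ.n≢0⇒n>0 (ℕ.≢-nonZero⁻¹ p))) (ℕ.s≤s (toℕ<n i))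

  nonzero≢𝟘 : ∀ i → nonzero i ≢ 𝟘
  nonzero≢𝟘 i = []≢𝟘 (ℕ.s≤s ℕ.z≤n) (1+i<p i)

  nonzero-injective : Injective _≡_ _≡_ nonzero
  nonzero-injective {i} {j} e = toℕ-injective (ℕ.suc-injective ([]-injective (1+i<p i) (1+i<p j) e))

  -- 2 p² (p − 1) conjugates: for (σ, u, x, z) the matrix with diagonal x and
  -- lower-left z ≠ 0 conjugate to u + σ β
  Index : Set
  Index = Fin 2 × Fp × Fp × Fin (p ℕ.∸ 1)

  conjugate : Index → M
  conjugate (s , u , x , i) = realise (𝟚 * u + σ s * tβ) (norm u (σ s)) x (nonzero i)

  conjugate∈S : ∀ t → S (conjugate t)
  conjugate∈S (s , u , x , i) = class∈S u (σ≢𝟘 s) {conjugate (s , u , x , i)} (nonzero≢𝟘 i)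
    (tr-realise T N x (nonzero i)) (Det-realise T N x {nonzero i} (nonzero≢𝟘 i))
    where
    T N : Fp
    T = 𝟚 * u + σ s * tβ
    N = norm u (σ s)

  conjugate-determines-σu : ∀ s s' u u' x i → conjugate (s , u , x , i) ≡ conjugate (s' , u' , x , i) → (s , u) ≡ (s' , u')
  conjugate-determines-σu s s' u u' x i e =
    trace-norm-injective s s' u u' (proj₁ tr-norm≡) (proj₂ tr-norm≡)
    where
    tr-norm≡ : 𝟚 * u + σ s * tβ ≡ 𝟚 * u' + σ s' * tβ × norm u (σ s) ≡ norm u' (σ s')
    tr-norm≡ = realise-injective {𝟚 * u + σ s * tβ} {𝟚 * u' + σ s' * tβ} {norm u (σ s)} {norm u' (σ s')} {x} {nonzero i} (nonzero≢𝟘 i) e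

  conjugate-injective : Injective _≡_ _≡_ conjugate
  conjugate-injective {s , u , x , i} {s' , u' , x' , i'} e = aligned (cong a e) (nonzero-injective (cong c e)) e
    where
    aligned : ∀ {x' i'} → x ≡ x' → i ≡ i' → conjugate (s , u , x , i) ≡ conjugate (s' , u' , x' , i') →
              (s , u , x , i) ≡ (s' , u' , x' , i')
    aligned refl refl e = cong (λ { (s , u) → s , u , x , i }) (conjugate-determines-σu s s' u u' x i e)

  -- the positions (x, z − 1) of the realising matrices
  positions : List (Fp × Fin (p ℕ.∸ 1))
  positions = cartesianProduct (allFin p) (allFin (p ℕ.∸ 1))

  indices : List Index
  indices = cartesianProduct (allFin 2) (cartesianProduct (allFin p) positions)

  indices-unique : Unique indices
  indices-unique = Unique.cartesianProduct⁺ (Unique.allFin⁺ 2) (Unique.cartesianProduct⁺ (Unique.allFin⁺ p)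
                     (Unique.cartesianProduct⁺ (Unique.allFin⁺ p) (Unique.allFin⁺ (p ℕ.∸ 1))))

  length-indices : length indices ≡ 2 ℕ.* (p ℕ.* (p ℕ.* (p ℕ.∸ 1)))
  length-indices = begin
    length indices                                                     ≡⟨ length-cartesianProduct (allFin 2) (cartesianProduct (allFin p) positions) ⟩
    length (allFin 2) ℕ.* length (cartesianProduct (allFin p) positions) ≡⟨ cong (length (allFin 2) ℕ.*_) (length-cartesianProduct (allFin p) positions) ⟩
    length (allFin 2) ℕ.* (length (allFin p) ℕ.* length positions)     ≡⟨ cong (λ l → length (allFin 2) ℕ.* (length (allFin p) ℕ.* l)) (length-cartesianProduct (allFin p) (allFin (p ℕ.∸ 1))) ⟩
    length (allFin 2) ℕ.* (length (allFin p) ℕ.* (length (allFin p) ℕ.* length (allFin (p ℕ.∸ 1))))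
      ≡⟨ cong₂ (λ k l → k ℕ.* (l ℕ.* (l ℕ.* length (allFin (p ℕ.∸ 1))))) (length-allFin 2) (length-allFin p) ⟩
    2 ℕ.* (p ℕ.* (p ℕ.* length (allFin (p ℕ.∸ 1))))                      ≡⟨ cong (λ l → 2 ℕ.* (p ℕ.* (p ℕ.* l))) (length-allFin (p ℕ.∸ 1)) ⟩
    2 ℕ.* (p ℕ.* (p ℕ.* (p ℕ.∸ 1)))                                      ∎

  more-than-p³ : CardGreater p S (p ^ 3)
  more-than-p³ = card-from-injection p indices indices-unique conjugate conjugate-injective conjugate∈S
                   (subst (p ^ 3 ℕ.<_) (sym length-indices) (cube<2q²[q-1] p (ℕ.≤-trans (ℕ.n≤1+n 3) (ℕ.≤-trans (ℕ.n≤1+n 4) 5≤p))))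

module GeneratesGL₂ (p : ℕ) .{{_ : NonZero p}} (5≤p : 5 ℕ.≤ p) (G : Mat p → Set) (cartan : IsNonSplitCartan p G) where

  open ResidueRing p
  open MatrixAlgebra p
  open Cartan p 5≤p G cartan
  open Conjugates p 5≤p G cartan
  open Generation using (gen-·; gen-∈)
  open ≡-Reasoning

  -- some u + β has nonzero trace: take u = 0 unless tβ = 0
  nonzero-trace : ∃ λ u → 𝟚 * u + 𝟙 * tβ ≢ 𝟘
  nonzero-trace with tβ Fin.≟ 𝟘
  ... | no tβ≢𝟘 = 𝟘 , λ e → tβ≢𝟘 (trans (solve 1 (λ t → t := (:𝟚 :* :𝟘 :+ :𝟙 :* t)) refl tβ) e)
  ... | yes tβ≡𝟘 = 𝟙 , λ e → 𝟚≢𝟘 (begin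
    𝟚                 ≡⟨ solve 0 (:𝟚 := (:𝟚 :* :𝟙 :+ :𝟙 :* :𝟘)) refl ⟩
    𝟚 * 𝟙 + 𝟙 * 𝟘     ≡⟨ cong (λ t → 𝟚 * 𝟙 + 𝟙 * t) tβ≡𝟘 ⟨
    𝟚 * 𝟙 + 𝟙 * tβ    ≡⟨ e ⟩
    𝟘                 ∎)

  u₀ T₀ N₀ : Fp
  u₀ = proj₁ nonzero-trace
  T₀ = 𝟚 * u₀ + 𝟙 * tβ
  N₀ = norm u₀ 𝟙

  2T₀≢𝟘 : T₀ + T₀ ≢ 𝟘
  2T₀≢𝟘 e = *-≢𝟘 𝟚≢𝟘 (proj₂ nonzero-trace) (trans (solve 1 (λ t → (:𝟚 :* t) := (t :+ t)) refl T₀) e)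

  -- γ = u₀ + β and −γ lie in G with traces ±T₀ and the same determinant N₀,
  -- so S contains every matrix with c ≠ 0, trace ±T₀ and determinant N₀
  in-γ-class : ∀ {m} → c m ≢ 𝟘 → tr m ≡ T₀ → Det m ≡ N₀ → S m
  in-γ-class = class∈S u₀ 𝟙≢𝟘

  in−γ-class : ∀ {m} → c m ≢ 𝟘 → tr m ≡ - T₀ → Det m ≡ N₀ → S m
  in−γ-class c≢𝟘 tr≡ Det≡ = class∈S (- u₀) (-≢𝟘 𝟙≢𝟘) c≢𝟘
    (trans tr≡ (solve 2 (λ u t → (:- (:𝟚 :* u :+ :𝟙 :* t)) := (:𝟚 :* (:- u) :+ (:- :𝟙) :* t)) refl u₀ tβ))
    (trans Det≡ (solve 3 (λ u t n → (u :* u :+ u :* :𝟙 :* t :+ :𝟙 :* :𝟙 :* n)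
                                  := ((:- u) :* (:- u) :+ (:- u) :* (:- :𝟙) :* t :+ (:- :𝟙) :* (:- :𝟙) :* n)) refl u₀ tβ nβ))

  open Elementary S T₀ N₀ 2T₀≢𝟘 (norm≢𝟘 u₀ 𝟙≢𝟘) in-γ-class in−γ-class

  -- every m ∈ GL₂ is g · (g⁻¹ m) with g = u + v β ∈ G of determinant det m
  -- and g⁻¹ m ∈ SL₂
  generated : ∀ m → IsGL p m → Generated p S m
  generated m m∈GL = from-norm (norm-surjective (Det m))
    where
    Det≢𝟘 : Det m ≢ 𝟘
    Det≢𝟘 e = m∈GL (trans (det≡Det m) e)
    from-norm : (∃₂ λ u v → norm u v ≡ Det m) → Generated p S m
    from-norm (u , v , norm≡) = subst (Generated p S) g·[g⁻¹·m]≡m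
        (gen-· S (gen-∈ S g∈S) (SL₂-generated S lower-generated upper-generated (g⁻¹ · m) Det-g⁻¹m))
      where
      g g⁻¹ : M
      g = el u v
      g⁻¹ = adj g
      Det-g : Det g ≡ Det m
      Det-g = trans (Det-el u v) norm≡
      g∈S : S g
      g∈S = ∼G⇒∈S {g} {g} (el∈G u v (λ e → Det≢𝟘 (trans (sym norm≡) e))) ∼-refl
      g-inverse : Inverses g g⁻¹
      g-inverse = adj-inverse g (λ e → Det≢𝟘 (trans (sym Det-g) e))
      Det-g⁻¹m : Det (g⁻¹ · m) ≡ 𝟙
      Det-g⁻¹m = begin
        Det (g⁻¹ · m)       ≡⟨ Det-· g⁻¹ m ⟩
        Det g⁻¹ * Det m     ≡⟨ *-comm (Det g⁻¹) (Det m) ⟩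
        Det m * Det g⁻¹     ≡⟨ cong (_* Det g⁻¹) Det-g ⟨
        Det g * Det g⁻¹     ≡⟨ Det-· g g⁻¹ ⟨
        Det (g · g⁻¹)       ≡⟨ cong Det (proj₁ g-inverse) ⟩
        Det I               ≡⟨ Det-I ⟩
        𝟙                   ∎
      g·[g⁻¹·m]≡m : g · (g⁻¹ · m) ≡ m
      g·[g⁻¹·m]≡m = begin
        g · (g⁻¹ · m)   ≡⟨ ·-assoc g g⁻¹ m ⟨
        g · g⁻¹ · m     ≡⟨ cong (_· m) (proj₁ g-inverse) ⟩
        I · m           ≡⟨ ·-identityˡ m ⟩
        m               ∎

-- Both halves of the theorem.
lemma6p1 : (p : ℕ) .{{_ : NonZero p}} → Prime p → 5 ≤ p →
    (G : Mat p → Set) → IsNonSplitCartan p G →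
    CardGreater p (ConjSet p G) (p ^ 3) × (∀ m → IsGL p m → Generated p (ConjSet p G) m)
lemma6p1 p _ 5≤p G cartan = Conjugates.more-than-p³ p 5≤p G cartan , GeneratesGL₂.generated p 5≤p G cartan
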